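{- Suppose $f(x),g(x)\in \mathbb{Z}[x]$ are both monic and that for infinitely many primes $\ell$, every root in $\overline{\mathbb{F}}_\ell$ of $f(x)$ (reduced modulo $\ell$) is also a root of $g(x)$ (reduced modulo $\ell$). Then $\operatorname{rad}(f)$ divides $\operatorname{rad}(g)$.
   Context: For a nonzero $f\in\mathbb{Q}[x]$ factored as $c\prod_i p_i^{e_i}$ with $c\in\mathbb{Q}^\times$ and $p_i$ distinct monic irreducible polynomials, $\operatorname{rad} f=\prod_i p_i$. -}

module Defs where

open import Level using (0ℓ)
open import Data.Nat as ℕ using (ℕ; zero; suc; _<_; _≤_)
open import Data.Integer as ℤ using (ℤ; +_; -[1+_])
open import Data.Rational as ℚ using (ℚ; 0ℚ; 1ℚ)
open import Data.List using (List; []; _∷_; map; foldr)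
open import Data.List.Relation.Unary.All using (All)
open import Data.List.Relation.Unary.AllPairs using (AllPairs)
open import Data.Product using (Σ; ∃; _×_; _,_; proj₁; proj₂)
open import Data.Sum using (_⊎_)
open import Relation.Nullary using (¬_)
open import Relation.Binary.PropositionalEquality using (_≡_)
open import Algebra.Bundles using (CommutativeRing)

-- Polynomials as coefficient lists, constant term first.
-- Trailing zeros are allowed; equality is coefficientwise.

coeff : {A : Set} → A → List A → ℕ → A
coeff z []       n       = z
coeff z (a ∷ p)  zero    = a
coeff z (a ∷ p)  (suc n) = coeff z p n

Polyℤ : Set
Polyℤ = List ℤ

Monicℤ : Polyℤ → Set
Monicℤ f = Σ ℕ λ d → coeff (+ 0) f d ≡ + 1 × (∀ n → d < n → coeff (+ 0) f n ≡ + 0)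

Polyℚ : Set
Polyℚ = List ℚ

_≈ₚ_ : Polyℚ → Polyℚ → Set
p ≈ₚ q = ∀ n → coeff 0ℚ p n ≡ coeff 0ℚ q n

_+ₚ_ : Polyℚ → Polyℚ → Polyℚ
[]      +ₚ q       = q
(a ∷ p) +ₚ []      = a ∷ p
(a ∷ p) +ₚ (b ∷ q) = (a ℚ.+ b) ∷ (p +ₚ q)

_*ₚ_ : Polyℚ → Polyℚ → Polyℚ
[]      *ₚ q = []
(a ∷ p) *ₚ q = map (a ℚ.*_) q +ₚ (0ℚ ∷ (p *ₚ q))

oneₚ : Polyℚ
oneₚ = 1ℚ ∷ []

constₚ : ℚ → Polyℚ
constₚ c = c ∷ []

_^ₚ_ : Polyℚ → ℕ → Polyℚ
p ^ₚ zero  = oneₚ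
p ^ₚ suc n = p *ₚ (p ^ₚ n)

prodₚ : List Polyℚ → Polyℚ
prodₚ = foldr _*ₚ_ oneₚ

_∣ₚ_ : Polyℚ → Polyℚ → Set
p ∣ₚ q = ∃ λ r → (r *ₚ p) ≈ₚ q

IsConst : Polyℚ → Set
IsConst p = ∀ n → 1 ≤ n → coeff 0ℚ p n ≡ 0ℚ

Monicℚ : Polyℚ → Set
Monicℚ p = Σ ℕ λ d → coeff 0ℚ p d ≡ 1ℚ × (∀ n → d < n → coeff 0ℚ p n ≡ 0ℚ)

-- irreducible in ℚ[x]: not zero and not a unit (i.e. nonconstant), and
-- in every factorisation one factor is a unit (a nonzero constant;
-- nonzero is automatic since p is nonzero)
Irreducible : Polyℚ → Set
Irreducible p = ¬ IsConst p × (∀ a b → p ≈ₚ (a *ₚ b) → IsConst a ⊎ IsConst b)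

toℚ[x] : Polyℤ → Polyℚ
toℚ[x] = map (λ z → z ℚ./ 1)

IsFactorization : Polyℚ → ℚ → List (Polyℚ × ℕ) → Set
IsFactorization f c fs =
  ¬ (c ≡ 0ℚ)
  × All (λ pe → Monicℚ (proj₁ pe) × Irreducible (proj₁ pe) × 1 ≤ proj₂ pe) fs
  × AllPairs (λ p q → ¬ (p ≈ₚ q)) (map proj₁ fs)
  × f ≈ₚ (constₚ c *ₚ prodₚ (map (λ pe → proj₁ pe ^ₚ proj₂ pe) fs))

radOf : List (Polyℚ × ℕ) → Polyℚ
radOf fs = prodₚ (map proj₁ fs)

module _ (K : CommutativeRing 0ℓ 0ℓ) where
  open CommutativeRing K

  IsField : Set
  IsField = ¬ (1# ≈ 0#) × (∀ x → ¬ (x ≈ 0#) → ∃ λ y → x * y ≈ 1#)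

  natK : ℕ → Carrier
  natK zero    = 0#
  natK (suc n) = 1# + natK n

  intK : ℤ → Carrier
  intK (+ n)      = natK n
  intK -[1+ n ]   = - natK (suc n)

  HasChar : ℕ → Set
  HasChar ℓ = natK ℓ ≈ 0#

  evalℤ : Polyℤ → Carrier → Carrier
  evalℤ f x = foldr (λ c acc → intK c + x * acc) 0# f

module Submission where

-- If a monic irreducible factor p of f over ℚ did not divide g, it would be coprime to g,
-- and clearing denominators in p ∣ f and in a Bézout identity U p + V g = 1 gives integer
-- identities H P = c₁ f and A P + B g = c₂ with P a positive integer multiple of p.
-- Modulo a prime ℓ beyond c₁, c₂ and the leading coefficient of P, the reduction of P is
-- nonconstant; for an irreducible factor q of it, the class of x in the field 𝔽ℓ[x]/(q) is
-- a root of P, hence of f, hence by hypothesis of g, hence of the unit c₂, which is absurd.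
-- So every monic irreducible factor of f equals one of those of g, and since the factors
-- of a factorisation are distinct, rad f divides rad g.

open import Defs
open import Data.Nat using (ℕ; _<_)
open import Data.Nat.Primality using (Prime)
open import Data.Rational as ℚ using (ℚ; 0ℚ; 1ℚ)
open import Data.List using (List)
open import Data.Product using (Σ; _×_)
open import Level using (0ℓ)
open import Algebra.Bundles using (CommutativeRing; NearSemiring)

open import Algebra.Morphism.Structures using (module NearSemiringMorphisms)
open import Data.Empty using (⊥; ⊥-elim)
open import Data.Integer as ℤ using (ℤ; +_; -[1+_]; _⊖_; 0ℤ; 1ℤ)
import Data.Integer.Properties as ℤ
open import Data.List as List using ([]; _∷_; [_]; map; foldr; length)
open import Data.List.Membership.Propositional using (_∈_; _─_)
open import Data.List.Membership.Propositional.Properties using (∈-map⁺; ∈-map⁻)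
import Data.List.Properties as List
open import Data.List.Relation.Unary.All as All using (All; []; _∷_)
import Data.List.Relation.Unary.All.Properties as All
open import Data.List.Relation.Unary.AllPairs as AllPairs using (AllPairs; []; _∷_)
open import Data.List.Relation.Unary.Any using (here; there)
open import Data.Maybe as Maybe using (Maybe)
open import Data.Nat as ℕ using (zero; suc; _≤_; z≤n; s≤s)
import Data.Nat.Coprimality as Coprimality
import Data.Nat.Properties as ℕ
open import Data.Product using (∃; _,_; proj₁; proj₂)
import Data.Rational.Properties as ℚ
import Data.Rational.Unnormalised as ℚᵘ
open import Data.Sign as Sign using (Sign)
open import Data.Sum using (_⊎_; inj₁; inj₂; [_,_]′)
open import Function using (id)
open import Relation.Binary.Bundles using (Setoid)
open import Relation.Binary.Definitions using (tri<; tri≈; tri>)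
open import Relation.Binary.PropositionalEquality as ≡ using (_≡_)
import Relation.Binary.Reasoning.Setoid as SetoidReasoning
open import Relation.Nullary using (¬_; Dec; yes; no)
open import Relation.Nullary.Decidable using (dec⇒maybe)

module IntegerCoefficients (R : CommutativeRing 0ℓ 0ℓ) where
  open CommutativeRing R
  open NearSemiring nearSemiring using (rawNearSemiring)
  open NearSemiringMorphisms using (IsNearSemiringHomomorphism)
  open SetoidReasoning setoid
  open import Algebra.Properties.Ring ring using (-0#≈0#; -‿involutive; -‿distribˡ-*; -‿distribʳ-*; -‿+-comm)
  open import Algebra.Properties.CommutativeSemigroup +-commutativeSemigroup using (interchange)

  natK-+ : ∀ m n → natK R (m ℕ.+ n) ≈ natK R m + natK R n
  natK-+ zero    n = sym (+-identityˡ _)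
  natK-+ (suc m) n = trans (+-congˡ (natK-+ m n)) (sym (+-assoc _ _ _))

  natK-* : ∀ m n → natK R (m ℕ.* n) ≈ natK R m * natK R n
  natK-* zero    n = sym (zeroˡ _)
  natK-* (suc m) n = begin
    natK R (n ℕ.+ m ℕ.* n)                ≈⟨ natK-+ n (m ℕ.* n) ⟩
    natK R n + natK R (m ℕ.* n)           ≈⟨ +-cong (sym (*-identityˡ _)) (natK-* m n) ⟩
    1# * natK R n + natK R m * natK R n   ≈⟨ distribʳ _ _ _ ⟨
    (1# + natK R m) * natK R n            ∎

  intK-⊖ : ∀ m n → intK R (m ⊖ n) ≈ natK R m - natK R n
  intK-⊖ m       zero    = trans (sym (+-identityʳ _)) (+-congˡ (sym -0#≈0#))
  intK-⊖ zero    (suc n) = sym (+-identityˡ _)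
  intK-⊖ (suc m) (suc n) = begin
    intK R (suc m ⊖ suc n)               ≡⟨ ≡.cong (intK R) (ℤ.[1+m]⊖[1+n]≡m⊖n m n) ⟩
    intK R (m ⊖ n)                       ≈⟨ intK-⊖ m n ⟩
    natK R m - natK R n                  ≈⟨ +-identityˡ _ ⟨
    0# + (natK R m - natK R n)           ≈⟨ +-congʳ (-‿inverseʳ 1#) ⟨
    (1# - 1#) + (natK R m - natK R n)    ≈⟨ interchange 1# (- 1#) (natK R m) (- natK R n) ⟩
    (1# + natK R m) + (- 1# - natK R n)  ≈⟨ +-congˡ (-‿+-comm 1# (natK R n)) ⟩
    (1# + natK R m) - (1# + natK R n)    ∎

  intK-+ : ∀ i j → intK R (i ℤ.+ j) ≈ intK R i + intK R j
  intK-+ (+ m)    (+ n)    = natK-+ m n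
  intK-+ (+ m)    -[1+ n ] = intK-⊖ m (suc n)
  intK-+ -[1+ m ] (+ n)    = trans (intK-⊖ n (suc m)) (+-comm _ _)
  intK-+ -[1+ m ] -[1+ n ] = begin
    - natK R (suc (suc (m ℕ.+ n)))       ≡⟨ ≡.cong (λ k → - natK R k) (ℕ.+-suc (suc m) n) ⟨
    - natK R (suc m ℕ.+ suc n)           ≈⟨ -‿cong (natK-+ (suc m) (suc n)) ⟩
    - (natK R (suc m) + natK R (suc n))  ≈⟨ -‿+-comm _ _ ⟨
    - natK R (suc m) - natK R (suc n)    ∎

  private
    signed : Sign → Carrier → Carrier
    signed Sign.+ x = x
    signed Sign.- x = - x

    signed-cong : ∀ s {x y} → x ≈ y → signed s x ≈ signed s y
    signed-cong Sign.+ e = e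
    signed-cong Sign.- e = -‿cong e

    intK-◃ : ∀ s n → intK R (s ℤ.◃ n) ≈ signed s (natK R n)
    intK-◃ Sign.+ zero    = refl
    intK-◃ Sign.- zero    = sym -0#≈0#
    intK-◃ Sign.+ (suc n) = refl
    intK-◃ Sign.- (suc n) = refl

    intK-signAbs : ∀ i → intK R i ≈ signed (ℤ.sign i) (natK R ℤ.∣ i ∣)
    intK-signAbs (+ n)    = refl
    intK-signAbs -[1+ n ] = refl

    signed-* : ∀ s t x y → signed (s Sign.* t) (x * y) ≈ signed s x * signed t y
    signed-* Sign.+ Sign.+ x y = refl
    signed-* Sign.+ Sign.- x y = -‿distribʳ-* x y
    signed-* Sign.- Sign.+ x y = -‿distribˡ-* x y
    signed-* Sign.- Sign.- x y = begin
      x * y           ≈⟨ -‿involutive _ ⟨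
      - - (x * y)     ≈⟨ -‿cong (-‿distribˡ-* x y) ⟩
      - ((- x) * y)   ≈⟨ -‿distribʳ-* (- x) y ⟩
      (- x) * (- y)   ∎

  intK-* : ∀ i j → intK R (i ℤ.* j) ≈ intK R i * intK R j
  intK-* i j = begin
    intK R (s ℤ.◃ ∣i∣ ℕ.* ∣j∣)                              ≈⟨ intK-◃ s (∣i∣ ℕ.* ∣j∣) ⟩
    signed s (natK R (∣i∣ ℕ.* ∣j∣))                         ≈⟨ signed-cong s (natK-* ∣i∣ ∣j∣) ⟩
    signed s (natK R ∣i∣ * natK R ∣j∣)                      ≈⟨ signed-* (ℤ.sign i) (ℤ.sign j) _ _ ⟩
    signed (ℤ.sign i) (natK R ∣i∣) * signed (ℤ.sign j) (natK R ∣j∣) ≈⟨ *-cong (intK-signAbs i) (intK-signAbs j) ⟨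
    intK R i * intK R j                                     ∎
    where
    s : Sign
    s = ℤ.sign i Sign.* ℤ.sign j
    ∣i∣ ∣j∣ : ℕ
    ∣i∣ = ℤ.∣ i ∣
    ∣j∣ = ℤ.∣ j ∣

  intK-neg : ∀ i → intK R (ℤ.- i) ≈ - intK R i
  intK-neg (+ zero)  = sym -0#≈0#
  intK-neg (+ suc n) = refl
  intK-neg -[1+ n ]  = sym (-‿involutive _)

  intK-isNearSemiringHomomorphism : IsNearSemiringHomomorphism ℤ.+-*-rawNearSemiring rawNearSemiring (intK R)
  intK-isNearSemiringHomomorphism = record
    { +-isMonoidHomomorphism = record
      { isMagmaHomomorphism = record { isRelHomomorphism = record { cong = λ i≡j → reflexive (≡.cong (intK R) i≡j) }
                                     ; homo = intK-+ }
      ; ε-homo = refl }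
    ; *-homo = intK-* }

  -- With coefficients in R itself, the normal forms of the solver could not
  -- decide coefficient equalities such as 1 + (-1) = 0; integers can.
  module Solver where
    open import Algebra.Solver.Ring.AlmostCommutativeRing
    private
      homomorphism : ℤ.+-*-rawRing -Raw-AlmostCommutative⟶ fromCommutativeRing R
      homomorphism = record
        { ⟦_⟧ = intK R ; +-homo = intK-+ ; *-homo = intK-* ; -‿homo = intK-neg
        ; 0-homo = refl ; 1-homo = +-identityʳ 1# }
      intK-≟ : ∀ i j → Maybe (intK R i ≈ intK R j)
      intK-≟ i j = Maybe.map (λ i≡j → reflexive (≡.cong (intK R) i≡j)) (dec⇒maybe (i ℤ.≟ j))
    open import Algebra.Solver.Ring ℤ.+-*-rawRing (fromCommutativeRing R) homomorphism intK-≟ public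

private
  ∈⇒≡⊎∈─ : ∀ {A : Set} {x y : A} {xs} (x∈xs : x ∈ xs) → y ∈ xs → y ≡ x ⊎ y ∈ xs ─ x∈xs
  ∈⇒≡⊎∈─ (here ≡.refl) (here y≡x)   = inj₁ y≡x
  ∈⇒≡⊎∈─ (here ≡.refl) (there y∈xs) = inj₂ y∈xs
  ∈⇒≡⊎∈─ (there x∈xs)  (here y≡z)   = inj₂ (here y≡z)
  ∈⇒≡⊎∈─ (there x∈xs)  (there y∈xs) with ∈⇒≡⊎∈─ x∈xs y∈xs
  ... | inj₁ y≡x    = inj₁ y≡x
  ... | inj₂ y∈xs─x = inj₂ (there y∈xs─x)

module Polynomial (R : CommutativeRing 0ℓ 0ℓ) where
  open CommutativeRing R hiding (zero)
  open SetoidReasoning setoid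
  open import Algebra.Properties.Ring ring using (-0#≈0#)
  open import Algebra.Properties.CommutativeSemigroup +-commutativeSemigroup using (interchange)

  Poly : Set
  Poly = List Carrier

  coef : Poly → ℕ → Carrier
  coef = coeff 0#

  infix 4 _≋_
  record _≋_ (p q : Poly) : Set where
    constructor mk≋
    field at : ∀ n → coef p n ≈ coef q n
  open _≋_ public

  infixl 6 _⊕_
  infixl 7 _⊗_
  infixr 8 _·_

  _⊕_ : Poly → Poly → Poly
  []      ⊕ q       = q
  (a ∷ p) ⊕ []      = a ∷ p
  (a ∷ p) ⊕ (b ∷ q) = (a + b) ∷ (p ⊕ q)

  _·_ : Carrier → Poly → Poly
  a · p = map (a *_) p

  _⊗_ : Poly → Poly → Poly
  []      ⊗ q = []
  (a ∷ p) ⊗ q = a · q ⊕ (0# ∷ p ⊗ q)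

  ⊝_ : Poly → Poly
  ⊝_ = map (-_)

  one : Poly
  one = [ 1# ]

  coef-⊕ : ∀ p q n → coef (p ⊕ q) n ≈ coef p n + coef q n
  coef-⊕ []      q       n       = sym (+-identityˡ _)
  coef-⊕ (a ∷ p) []      zero    = sym (+-identityʳ _)
  coef-⊕ (a ∷ p) []      (suc n) = sym (+-identityʳ _)
  coef-⊕ (a ∷ p) (b ∷ q) zero    = refl
  coef-⊕ (a ∷ p) (b ∷ q) (suc n) = coef-⊕ p q n

  coef-· : ∀ a p n → coef (a · p) n ≈ a * coef p n
  coef-· a []      n       = sym (zeroʳ a)
  coef-· a (b ∷ p) zero    = refl
  coef-· a (b ∷ p) (suc n) = coef-· a p n

  coef-⊝ : ∀ p n → coef (⊝ p) n ≈ - coef p n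
  coef-⊝ []      n       = sym -0#≈0#
  coef-⊝ (b ∷ p) zero    = refl
  coef-⊝ (b ∷ p) (suc n) = coef-⊝ p n

  ≋-refl : ∀ {p} → p ≋ p
  ≋-refl = mk≋ λ _ → refl

  ≋-sym : ∀ {p q} → p ≋ q → q ≋ p
  ≋-sym e = mk≋ λ n → sym (at e n)

  ≋-trans : ∀ {p q r} → p ≋ q → q ≋ r → p ≋ r
  ≋-trans e f = mk≋ λ n → trans (at e n) (at f n)

  ≋-setoid : Setoid 0ℓ 0ℓ
  ≋-setoid = record
    { Carrier = Poly ; _≈_ = _≋_
    ; isEquivalence = record { refl = ≋-refl ; sym = ≋-sym ; trans = ≋-trans } }

  ∷-cong : ∀ {a b p q} → a ≈ b → p ≋ q → (a ∷ p) ≋ (b ∷ q)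
  ∷-cong e f = mk≋ λ { zero → e ; (suc n) → at f n }

  ∷-injective : ∀ {a b p q} → (a ∷ p) ≋ (b ∷ q) → a ≈ b × p ≋ q
  ∷-injective e = at e zero , mk≋ λ n → at e (suc n)

  ∷≋[] : ∀ {a p} → a ≈ 0# → p ≋ [] → (a ∷ p) ≋ []
  ∷≋[] e f = mk≋ λ { zero → e ; (suc n) → at f n }

  ∷≋[]⁻¹ : ∀ {a p} → (a ∷ p) ≋ [] → a ≈ 0# × p ≋ []
  ∷≋[]⁻¹ e = at e zero , mk≋ λ n → at e (suc n)

  ⊕-cong : ∀ {p p′ q q′} → p ≋ p′ → q ≋ q′ → p ⊕ q ≋ p′ ⊕ q′
  ⊕-cong {p} {p′} {q} {q′} e f = mk≋ λ n → begin
    coef (p ⊕ q) n        ≈⟨ coef-⊕ p q n ⟩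
    coef p n + coef q n   ≈⟨ +-cong (at e n) (at f n) ⟩
    coef p′ n + coef q′ n ≈⟨ coef-⊕ p′ q′ n ⟨
    coef (p′ ⊕ q′) n      ∎

  ·-cong : ∀ {a b p q} → a ≈ b → p ≋ q → a · p ≋ b · q
  ·-cong {a} {b} {p} {q} e f = mk≋ λ n → begin
    coef (a · p) n ≈⟨ coef-· a p n ⟩
    a * coef p n   ≈⟨ *-cong e (at f n) ⟩
    b * coef q n   ≈⟨ coef-· b q n ⟨
    coef (b · q) n ∎

  ⊝-cong : ∀ {p q} → p ≋ q → ⊝ p ≋ ⊝ q
  ⊝-cong {p} {q} f = mk≋ λ n → begin
    coef (⊝ p) n ≈⟨ coef-⊝ p n ⟩
    - coef p n   ≈⟨ -‿cong (at f n) ⟩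
    - coef q n   ≈⟨ coef-⊝ q n ⟨
    coef (⊝ q) n ∎

  ⊕-comm : ∀ p q → p ⊕ q ≋ q ⊕ p
  ⊕-comm p q = mk≋ λ n → begin
    coef (p ⊕ q) n      ≈⟨ coef-⊕ p q n ⟩
    coef p n + coef q n ≈⟨ +-comm _ _ ⟩
    coef q n + coef p n ≈⟨ coef-⊕ q p n ⟨
    coef (q ⊕ p) n      ∎

  ⊕-assoc : ∀ p q r → (p ⊕ q) ⊕ r ≋ p ⊕ (q ⊕ r)
  ⊕-assoc p q r = mk≋ λ n → begin
    coef ((p ⊕ q) ⊕ r) n             ≈⟨ coef-⊕ (p ⊕ q) r n ⟩
    coef (p ⊕ q) n + coef r n        ≈⟨ +-congʳ (coef-⊕ p q n) ⟩
    (coef p n + coef q n) + coef r n ≈⟨ +-assoc _ _ _ ⟩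
    coef p n + (coef q n + coef r n) ≈⟨ +-congˡ (coef-⊕ q r n) ⟨
    coef p n + coef (q ⊕ r) n        ≈⟨ coef-⊕ p (q ⊕ r) n ⟨
    coef (p ⊕ (q ⊕ r)) n             ∎

  ⊕-identityʳ : ∀ p → p ⊕ [] ≋ p
  ⊕-identityʳ []      = ≋-refl
  ⊕-identityʳ (a ∷ p) = ≋-refl

  ⊕-inverseʳ : ∀ p → p ⊕ ⊝ p ≋ []
  ⊕-inverseʳ p = mk≋ λ n → begin
    coef (p ⊕ ⊝ p) n         ≈⟨ coef-⊕ p (⊝ p) n ⟩
    coef p n + coef (⊝ p) n  ≈⟨ +-congˡ (coef-⊝ p n) ⟩
    coef p n - coef p n      ≈⟨ -‿inverseʳ _ ⟩
    0#                       ∎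

  ⊕-inverseˡ : ∀ p → ⊝ p ⊕ p ≋ []
  ⊕-inverseˡ p = ≋-trans (⊕-comm (⊝ p) p) (⊕-inverseʳ p)

  ⊕-interchange : ∀ p q r s → (p ⊕ q) ⊕ (r ⊕ s) ≋ (p ⊕ r) ⊕ (q ⊕ s)
  ⊕-interchange p q r s = mk≋ λ n → begin
    coef ((p ⊕ q) ⊕ (r ⊕ s)) n                    ≈⟨ coef-⊕ (p ⊕ q) (r ⊕ s) n ⟩
    coef (p ⊕ q) n + coef (r ⊕ s) n               ≈⟨ +-cong (coef-⊕ p q n) (coef-⊕ r s n) ⟩
    (coef p n + coef q n) + (coef r n + coef s n) ≈⟨ interchange _ _ _ _ ⟩
    (coef p n + coef r n) + (coef q n + coef s n) ≈⟨ +-cong (coef-⊕ p r n) (coef-⊕ q s n) ⟨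
    coef (p ⊕ r) n + coef (q ⊕ s) n               ≈⟨ coef-⊕ (p ⊕ r) (q ⊕ s) n ⟨
    coef ((p ⊕ r) ⊕ (q ⊕ s)) n                    ∎

  ·-distribˡ-⊕ : ∀ a p q → a · (p ⊕ q) ≋ a · p ⊕ a · q
  ·-distribˡ-⊕ a p q = mk≋ λ n → begin
    coef (a · (p ⊕ q)) n            ≈⟨ coef-· a (p ⊕ q) n ⟩
    a * coef (p ⊕ q) n              ≈⟨ *-congˡ (coef-⊕ p q n) ⟩
    a * (coef p n + coef q n)       ≈⟨ distribˡ _ _ _ ⟩
    a * coef p n + a * coef q n     ≈⟨ +-cong (coef-· a p n) (coef-· a q n) ⟨
    coef (a · p) n + coef (a · q) n ≈⟨ coef-⊕ (a · p) (a · q) n ⟨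
    coef (a · p ⊕ a · q) n          ∎

  ·-distribʳ-+ : ∀ a b p → (a + b) · p ≋ a · p ⊕ b · p
  ·-distribʳ-+ a b p = mk≋ λ n → begin
    coef ((a + b) · p) n            ≈⟨ coef-· (a + b) p n ⟩
    (a + b) * coef p n              ≈⟨ distribʳ _ _ _ ⟩
    a * coef p n + b * coef p n     ≈⟨ +-cong (coef-· a p n) (coef-· b p n) ⟨
    coef (a · p) n + coef (b · p) n ≈⟨ coef-⊕ (a · p) (b · p) n ⟨
    coef (a · p ⊕ b · p) n          ∎

  ·-assoc : ∀ a b p → (a * b) · p ≋ a · (b · p)
  ·-assoc a b p = mk≋ λ n → begin
    coef ((a * b) · p) n ≈⟨ coef-· (a * b) p n ⟩
    (a * b) * coef p n   ≈⟨ *-assoc _ _ _ ⟩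
    a * (b * coef p n)   ≈⟨ *-congˡ (coef-· b p n) ⟨
    a * coef (b · p) n   ≈⟨ coef-· a (b · p) n ⟨
    coef (a · (b · p)) n ∎

  ·-zeroˡ : ∀ p → 0# · p ≋ []
  ·-zeroˡ p = mk≋ λ n → trans (coef-· 0# p n) (zeroˡ _)

  ·-identityˡ : ∀ p → 1# · p ≋ p
  ·-identityˡ p = mk≋ λ n → trans (coef-· 1# p n) (*-identityˡ _)

  ⊗-zeroʳ : ∀ p → p ⊗ [] ≋ []
  ⊗-zeroʳ []      = ≋-refl
  ⊗-zeroʳ (a ∷ p) = ∷≋[] refl (⊗-zeroʳ p)

  ≋[]⇒⊗≋[] : ∀ {p} q → p ≋ [] → p ⊗ q ≋ []
  ≋[]⇒⊗≋[] {[]}    q e = ≋-refl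
  ≋[]⇒⊗≋[] {a ∷ p} q e with ∷≋[]⁻¹ e
  ... | a≈0 , p≋[] = ⊕-cong (≋-trans (·-cong a≈0 ≋-refl) (·-zeroˡ q)) (∷≋[] refl (≋[]⇒⊗≋[] q p≋[]))

  ⊗-congˡ : ∀ {p p′} q → p ≋ p′ → p ⊗ q ≋ p′ ⊗ q
  ⊗-congˡ {[]}    {p′}      q e = ≋-sym (≋[]⇒⊗≋[] q (≋-sym e))
  ⊗-congˡ {a ∷ p} {[]}      q e = ≋[]⇒⊗≋[] q e
  ⊗-congˡ {a ∷ p} {a′ ∷ p′} q e with ∷-injective e
  ... | a≈a′ , p≋p′ = ⊕-cong (·-cong a≈a′ ≋-refl) (∷-cong refl (⊗-congˡ q p≋p′))

  ⊗-congʳ : ∀ p {q q′} → q ≋ q′ → p ⊗ q ≋ p ⊗ q′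
  ⊗-congʳ []      e = ≋-refl
  ⊗-congʳ (a ∷ p) e = ⊕-cong (·-cong refl e) (∷-cong refl (⊗-congʳ p e))

  ⊗-cong : ∀ {p p′ q q′} → p ≋ p′ → q ≋ q′ → p ⊗ q ≋ p′ ⊗ q′
  ⊗-cong {p′ = p′} {q = q} e f = ≋-trans (⊗-congˡ q e) (⊗-congʳ p′ f)

  private
    0∷-⊕ : ∀ p q → (0# ∷ p ⊕ q) ≋ (0# ∷ p) ⊕ (0# ∷ q)
    0∷-⊕ p q = ∷-cong (sym (+-identityˡ 0#)) ≋-refl

  ⊗-distribʳ : ∀ p p′ q → (p ⊕ p′) ⊗ q ≋ p ⊗ q ⊕ p′ ⊗ q
  ⊗-distribʳ []      p′       q = ≋-refl
  ⊗-distribʳ (a ∷ p) []       q = ≋-sym (⊕-identityʳ _)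
  ⊗-distribʳ (a ∷ p) (b ∷ p′) q = ≋-trans
    (⊕-cong (·-distribʳ-+ a b q) (≋-trans (∷-cong refl (⊗-distribʳ p p′ q)) (0∷-⊕ (p ⊗ q) (p′ ⊗ q))))
    (⊕-interchange (a · q) (b · q) (0# ∷ p ⊗ q) (0# ∷ p′ ⊗ q))

  ⊗-distribˡ : ∀ p q q′ → p ⊗ (q ⊕ q′) ≋ p ⊗ q ⊕ p ⊗ q′
  ⊗-distribˡ []      q q′ = ≋-refl
  ⊗-distribˡ (a ∷ p) q q′ = ≋-trans
    (⊕-cong (·-distribˡ-⊕ a q q′) (≋-trans (∷-cong refl (⊗-distribˡ p q q′)) (0∷-⊕ (p ⊗ q) (p ⊗ q′))))
    (⊕-interchange (a · q) (a · q′) (0# ∷ p ⊗ q) (0# ∷ p ⊗ q′))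

  ·-⊗ : ∀ a p q → (a · p) ⊗ q ≋ a · (p ⊗ q)
  ·-⊗ a []      q = ≋-refl
  ·-⊗ a (b ∷ p) q = ≋-trans
    (⊕-cong (·-assoc a b q) (∷-cong (sym (zeroʳ a)) (·-⊗ a p q)))
    (≋-sym (·-distribˡ-⊕ a (b · q) (0# ∷ p ⊗ q)))

  ⊗-[] : ∀ p b → p ⊗ [ b ] ≋ b · p
  ⊗-[] []      b = ≋-refl
  ⊗-[] (a ∷ p) b = ∷-cong (trans (+-identityʳ _) (*-comm a b)) (⊗-[] p b)

  []-⊗ : ∀ b p → [ b ] ⊗ p ≋ b · p
  []-⊗ b p = ≋-trans (⊕-cong ≋-refl (∷≋[] refl ≋-refl)) (⊕-identityʳ (b · p))

  ⊗-0∷ : ∀ p q → p ⊗ (0# ∷ q) ≋ (0# ∷ p ⊗ q)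
  ⊗-0∷ []      q = ≋-sym (∷≋[] refl ≋-refl)
  ⊗-0∷ (a ∷ p) q = ∷-cong (trans (+-identityʳ _) (zeroʳ a)) (⊕-cong ≋-refl (⊗-0∷ p q))

  ⊗-comm : ∀ p q → p ⊗ q ≋ q ⊗ p
  ⊗-comm []      q = ≋-sym (⊗-zeroʳ q)
  ⊗-comm (a ∷ p) q = ≋-sym (≋-trans (⊗-congʳ q (∷-cong (sym (+-identityʳ a)) ≋-refl))
    (≋-trans (⊗-distribˡ q [ a ] (0# ∷ p))
      (⊕-cong (⊗-[] q a) (≋-trans (⊗-0∷ q p) (∷-cong refl (⊗-comm q p))))))

  ⊗-assoc : ∀ p q r → (p ⊗ q) ⊗ r ≋ p ⊗ (q ⊗ r)
  ⊗-assoc []      q r = ≋-refl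
  ⊗-assoc (a ∷ p) q r = ≋-trans (⊗-distribʳ (a · q) (0# ∷ p ⊗ q) r)
    (⊕-cong (·-⊗ a q r) (≋-trans (0∷-⊗ (p ⊗ q) r) (∷-cong refl (⊗-assoc p q r))))
    where
    0∷-⊗ : ∀ p q → (0# ∷ p) ⊗ q ≋ (0# ∷ p ⊗ q)
    0∷-⊗ p q = ⊕-cong (·-zeroˡ q) ≋-refl

  ⊗-identityˡ : ∀ p → one ⊗ p ≋ p
  ⊗-identityˡ p = ≋-trans ([]-⊗ 1# p) (·-identityˡ p)

  ⊗-identityʳ : ∀ p → p ⊗ one ≋ p
  ⊗-identityʳ p = ≋-trans (⊗-comm p one) (⊗-identityˡ p)

  +-*-commutativeRing : CommutativeRing 0ℓ 0ℓ
  +-*-commutativeRing = record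
    { Carrier = Poly ; _≈_ = _≋_ ; _+_ = _⊕_ ; _*_ = _⊗_ ; -_ = ⊝_ ; 0# = [] ; 1# = one
    ; isCommutativeRing = record
      { isRing = record
        { +-isAbelianGroup = record
          { isGroup = record
            { isMonoid = record
              { isSemigroup = record
                { isMagma = record { isEquivalence = Setoid.isEquivalence ≋-setoid ; ∙-cong = ⊕-cong }
                ; assoc = ⊕-assoc }
              ; identity = (λ _ → ≋-refl) , ⊕-identityʳ }
            ; inverse = ⊕-inverseˡ , ⊕-inverseʳ
            ; ⁻¹-cong = ⊝-cong }
          ; comm = ⊕-comm }
        ; *-cong = ⊗-cong
        ; *-assoc = ⊗-assoc
        ; *-identity = ⊗-identityˡ , ⊗-identityʳ
        ; distrib = ⊗-distribˡ , λ r p q → ⊗-distribʳ p q r }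
      ; *-comm = ⊗-comm } }

  module Solver = IntegerCoefficients.Solver +-*-commutativeRing

  infix 4 _∣_
  _∣_ : Poly → Poly → Set
  p ∣ q = ∃ λ r → r ⊗ p ≋ q

  ∣-refl : ∀ p → p ∣ p
  ∣-refl p = one , ⊗-identityˡ p

  ∣-respʳ : ∀ {p q q′} → q ≋ q′ → p ∣ q → p ∣ q′
  ∣-respʳ e (r , rp≋q) = r , ≋-trans rp≋q e

  ∣-trans : ∀ {p q s} → p ∣ q → q ∣ s → p ∣ s
  ∣-trans {p} (r , rp≋q) (r′ , r′q≋s) = r′ ⊗ r , ≋-trans (⊗-assoc r′ r p) (≋-trans (⊗-congʳ r′ rp≋q) r′q≋s)

  _∣[] : ∀ p → p ∣ []
  p ∣[] = [] , ≋-refl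

  n∣m⊗n : ∀ m n → n ∣ m ⊗ n
  n∣m⊗n m n = m , ≋-refl

  ∣n⇒∣m⊗n : ∀ {p n} m → p ∣ n → p ∣ m ⊗ n
  ∣n⇒∣m⊗n {p} m (r , rp≋n) = m ⊗ r , ≋-trans (⊗-assoc m r p) (⊗-congʳ m rp≋n)

  ∣m⇒∣m⊗n : ∀ {p m} n → p ∣ m → p ∣ m ⊗ n
  ∣m⇒∣m⊗n {m = m} n p∣m = ∣-respʳ (⊗-comm n m) (∣n⇒∣m⊗n n p∣m)

  ∣m∣n⇒∣m⊕n : ∀ {p m n} → p ∣ m → p ∣ n → p ∣ m ⊕ n
  ∣m∣n⇒∣m⊕n {p} (r , rp≋m) (r′ , r′p≋n) = r ⊕ r′ , ≋-trans (⊗-distribʳ r r′ p) (⊕-cong rp≋m r′p≋n)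

  ∣n⇒∣⊝n : ∀ {p n} → p ∣ n → p ∣ ⊝ n
  ∣n⇒∣⊝n {p} (r , rp≋n) = ⊝ r , ≋-trans (solve 2 (λ r p → (:- r) :* p := :- (r :* p)) ≋-refl r p) (⊝-cong rp≋n)
    where open Solver

  ∣-cancel-unit : ∀ {q u n} → u ∣ one → q ∣ u ⊗ n → q ∣ n
  ∣-cancel-unit {q} {u} {n} (w , wu≋1) q∣un = ∣-respʳ wun≋n (∣n⇒∣m⊗n w q∣un)
    where
    wun≋n : w ⊗ (u ⊗ n) ≋ n
    wun≋n = ≋-trans (≋-sym (⊗-assoc w u n)) (≋-trans (⊗-congˡ n wu≋1) (⊗-identityˡ n))

  DegreeBelow : ℕ → Poly → Set
  DegreeBelow k p = ∀ n → k ≤ n → coef p n ≈ 0#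

  IsConstant : Poly → Set
  IsConstant = DegreeBelow 1

  IsIrreducible : Poly → Set
  IsIrreducible p = ∀ a b → p ≋ a ⊗ b → IsConstant a ⊎ IsConstant b

  IsMonic : Poly → Set
  IsMonic p = ∃ λ d → coef p d ≈ 1# × DegreeBelow (suc d) p

  DegreeBelow-mono : ∀ {k k′ p} → k ≤ k′ → DegreeBelow k p → DegreeBelow k′ p
  DegreeBelow-mono k≤k′ deg n k′≤n = deg n (ℕ.≤-trans k≤k′ k′≤n)

  DegreeBelow-length : ∀ p → DegreeBelow (length p) p
  DegreeBelow-length []      n       _         = refl
  DegreeBelow-length (a ∷ p) (suc n) (s≤s le) = DegreeBelow-length p n le

  ≋[]⇒IsConstant : ∀ {p} → p ≋ [] → IsConstant p
  ≋[]⇒IsConstant p≋[] n _ = at p≋[] n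

  IsConstant⇒≋[coef0] : ∀ {p} → IsConstant p → p ≋ [ coef p 0 ]
  IsConstant⇒≋[coef0] {[]}    _ = ≋-sym (∷≋[] refl ≋-refl)
  IsConstant⇒≋[coef0] {a ∷ p} c = ∷-cong refl (mk≋ λ n → c (suc n) (s≤s z≤n))

  coef-[]⊗ : ∀ c p n → coef ([ c ] ⊗ p) n ≈ c * coef p n
  coef-[]⊗ c p n = trans (at ([]-⊗ c p) n) (coef-· c p n)

  private
    coef-∷⊗ : ∀ c a b n → coef ((c ∷ a) ⊗ b) (suc n) ≈ c * coef b (suc n) + coef (a ⊗ b) n
    coef-∷⊗ c a b n = trans (coef-⊕ (c · b) (0# ∷ a ⊗ b) (suc n)) (+-congʳ (coef-· c b (suc n)))

  leading-⊗ : ∀ a b da db → DegreeBelow (suc da) a → DegreeBelow (suc db) b →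
              DegreeBelow (suc (da ℕ.+ db)) (a ⊗ b) × coef (a ⊗ b) (da ℕ.+ db) ≈ coef a da * coef b db
  leading-⊗ [] b da db _ _ = (λ _ _ → refl) , sym (zeroˡ _)
  leading-⊗ (c ∷ a) b zero db degA degB =
    (λ n db<n → trans (coef-c⊗b n) (trans (*-congˡ (degB n db<n)) (zeroʳ c))) , coef-c⊗b db
    where
    coef-c⊗b : ∀ n → coef ((c ∷ a) ⊗ b) n ≈ c * coef b n
    coef-c⊗b n = trans (at (⊗-congˡ b (IsConstant⇒≋[coef0] {c ∷ a} degA)) n) (coef-[]⊗ c b n)
  leading-⊗ (c ∷ a) b (suc da) db degA degB = deg , lead
    where
    ih : DegreeBelow (suc (da ℕ.+ db)) (a ⊗ b) × coef (a ⊗ b) (da ℕ.+ db) ≈ coef a da * coef b db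
    ih = leading-⊗ a b da db (λ n lt → degA (suc n) (s≤s lt)) degB
    c*coef-b≈0 : ∀ n → db ℕ.≤ n → c * coef b (suc n) ≈ 0#
    c*coef-b≈0 n db≤n = trans (*-congˡ (degB (suc n) (s≤s db≤n))) (zeroʳ c)
    deg : DegreeBelow (suc (suc da ℕ.+ db)) ((c ∷ a) ⊗ b)
    deg (suc n) (s≤s lt) = trans (coef-∷⊗ c a b n)
      (trans (+-cong (c*coef-b≈0 n (ℕ.≤-trans (ℕ.m≤n+m db da) (ℕ.<⇒≤ lt))) (proj₁ ih n lt)) (+-identityˡ 0#))
    lead : coef ((c ∷ a) ⊗ b) (suc da ℕ.+ db) ≈ coef a da * coef b db
    lead = trans (coef-∷⊗ c a b (da ℕ.+ db))
      (trans (+-cong (c*coef-b≈0 _ (ℕ.m≤n+m db da)) (proj₂ ih)) (+-identityˡ _))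

  ∏ : List Poly → Poly
  ∏ = foldr _⊗_ one

  infixr 8 _^_
  _^_ : Poly → ℕ → Poly
  p ^ zero  = one
  p ^ suc n = p ⊗ p ^ n

  ∈⇒∣∏ : ∀ {x xs} → x ∈ xs → x ∣ ∏ xs
  ∈⇒∣∏ {x} {.x ∷ xs} (here ≡.refl) = ∣-respʳ (⊗-comm (∏ xs) x) (n∣m⊗n (∏ xs) x)
  ∈⇒∣∏ {x} {y ∷ xs}  (there x∈xs)  = ∣n⇒∣m⊗n y (∈⇒∣∏ x∈xs)

  ∏-─ : ∀ {x xs} (x∈xs : x ∈ xs) → ∏ xs ≋ x ⊗ ∏ (xs ─ x∈xs)
  ∏-─ (here ≡.refl) = ≋-refl
  ∏-─ {x} {y ∷ xs} (there x∈xs) = ≋-trans (⊗-congʳ y (∏-─ x∈xs))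
    (solve 3 (λ y x r → y :* (x :* r) := x :* (y :* r)) ≋-refl y x (∏ (xs ─ x∈xs)))
    where open Solver

  AssociateIn : List Poly → Poly → Set
  AssociateIn qs p = ∃ λ q → q ∈ qs × p ≋ q

  private
    AssociateIn-─ : ∀ {p q qs ps} (q∈qs : q ∈ qs) → p ≋ q → All (λ p′ → ¬ p ≋ p′) ps →
                    All (AssociateIn qs) ps → All (AssociateIn (qs ─ q∈qs)) ps
    AssociateIn-─ q∈qs p≋q []               []                                 = []
    AssociateIn-─ q∈qs p≋q (p≉p′ ∷ p≉ps) ((q′ , q′∈qs , p′≋q′) ∷ associates) with ∈⇒≡⊎∈─ q∈qs q′∈qs
    ... | inj₁ ≡.refl  = ⊥-elim (p≉p′ (≋-trans p≋q (≋-sym p′≋q′)))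
    ... | inj₂ q′∈qs─q = (q′ , q′∈qs─q , p′≋q′) ∷ AssociateIn-─ q∈qs p≋q p≉ps associates

  distinct⇒∏∣∏ : ∀ ps qs → AllPairs (λ p p′ → ¬ p ≋ p′) ps → All (AssociateIn qs) ps → ∏ ps ∣ ∏ qs
  distinct⇒∏∣∏ []       qs _ _ = ∏ qs , ⊗-identityʳ (∏ qs)
  distinct⇒∏∣∏ (p ∷ ps) qs (p≉ps ∷ distinct) ((q , q∈qs , p≋q) ∷ associates)
    with distinct⇒∏∣∏ ps (qs ─ q∈qs) distinct (AssociateIn-─ q∈qs p≋q p≉ps associates)
  ... | r , r∏ps≋∏qs─q = r , ≋-trans
    (solve 3 (λ r p s → r :* (p :* s) := p :* (r :* s)) ≋-refl r p (∏ ps))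
    (≋-trans (⊗-cong p≋q r∏ps≋∏qs─q) (≋-sym (∏-─ q∈qs)))
    where open Solver

module PolynomialMap (R S : CommutativeRing 0ℓ 0ℓ)
  {φ : CommutativeRing.Carrier R → CommutativeRing.Carrier S}
  (isHom : NearSemiringMorphisms.IsNearSemiringHomomorphism
             (NearSemiring.rawNearSemiring (CommutativeRing.nearSemiring R))
             (NearSemiring.rawNearSemiring (CommutativeRing.nearSemiring S)) φ)
  where
  private
    module R = CommutativeRing R
    module S = CommutativeRing S
    module R[x] = Polynomial R
    module S[x] = Polynomial S
  open NearSemiringMorphisms.IsNearSemiringHomomorphism isHom
  open S[x] using (_≋_; mk≋; at; ≋-trans; ⊕-cong; ∷-cong)
  open SetoidReasoning S.setoid

  coef-map : ∀ p n → S[x].coef (map φ p) n S.≈ φ (R[x].coef p n)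
  coef-map []      n       = S.sym 0#-homo
  coef-map (a ∷ p) zero    = S.refl
  coef-map (a ∷ p) (suc n) = coef-map p n

  map-cong : ∀ {p q} → p R[x].≋ q → map φ p ≋ map φ q
  map-cong {p} {q} e = mk≋ λ n → begin
    S[x].coef (map φ p) n ≈⟨ coef-map p n ⟩
    φ (R[x].coef p n)     ≈⟨ ⟦⟧-cong (R[x].at e n) ⟩
    φ (R[x].coef q n)     ≈⟨ coef-map q n ⟨
    S[x].coef (map φ q) n ∎

  map-injective : (∀ {a b} → φ a S.≈ φ b → a R.≈ b) → ∀ {p q} → map φ p ≋ map φ q → p R[x].≋ q
  map-injective φ-injective {p} {q} e = R[x].mk≋ λ n →
    φ-injective (S.trans (S.sym (coef-map p n)) (S.trans (at e n) (coef-map q n)))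

  map-⊕ : ∀ p q → map φ (p R[x].⊕ q) ≋ map φ p S[x].⊕ map φ q
  map-⊕ p q = mk≋ λ n → begin
    S[x].coef (map φ (p R[x].⊕ q)) n                    ≈⟨ coef-map (p R[x].⊕ q) n ⟩
    φ (R[x].coef (p R[x].⊕ q) n)                        ≈⟨ ⟦⟧-cong (R[x].coef-⊕ p q n) ⟩
    φ (R[x].coef p n R.+ R[x].coef q n)                 ≈⟨ +-homo _ _ ⟩
    φ (R[x].coef p n) S.+ φ (R[x].coef q n)             ≈⟨ S.+-cong (coef-map p n) (coef-map q n) ⟨
    S[x].coef (map φ p) n S.+ S[x].coef (map φ q) n     ≈⟨ S[x].coef-⊕ (map φ p) (map φ q) n ⟨
    S[x].coef (map φ p S[x].⊕ map φ q) n                ∎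

  map-· : ∀ a p → map φ (a R[x].· p) ≋ φ a S[x].· map φ p
  map-· a p = mk≋ λ n → begin
    S[x].coef (map φ (a R[x].· p)) n   ≈⟨ coef-map (a R[x].· p) n ⟩
    φ (R[x].coef (a R[x].· p) n)       ≈⟨ ⟦⟧-cong (R[x].coef-· a p n) ⟩
    φ (a R.* R[x].coef p n)            ≈⟨ *-homo _ _ ⟩
    φ a S.* φ (R[x].coef p n)          ≈⟨ S.*-congˡ (coef-map p n) ⟨
    φ a S.* S[x].coef (map φ p) n      ≈⟨ S[x].coef-· (φ a) (map φ p) n ⟨
    S[x].coef (φ a S[x].· map φ p) n   ∎

  map-⊗ : ∀ p q → map φ (p R[x].⊗ q) ≋ map φ p S[x].⊗ map φ q
  map-⊗ []      q = S[x].≋-refl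
  map-⊗ (a ∷ p) q = ≋-trans (map-⊕ (a R[x].· q) (R.0# ∷ p R[x].⊗ q))
    (⊕-cong (map-· a q) (∷-cong 0#-homo (map-⊗ p q)))

module PolynomialOverField (F : CommutativeRing 0ℓ 0ℓ) (F-isField : IsField F)
  (_≈0? : ∀ a → Dec (CommutativeRing._≈_ F a (CommutativeRing.0# F))) where
  open CommutativeRing F hiding (zero)
  open Polynomial F
  open Solver
  open SetoidReasoning setoid
  open import Algebra.Properties.Ring ring using (-0#≈0#)
  open import Algebra.Properties.CommutativeSemigroup *-commutativeSemigroup using (xy∙z≈y∙xz)

  private
    1≉0 : ¬ 1# ≈ 0#
    1≉0 = proj₁ F-isField

    inverse : ∀ a → ¬ a ≈ 0# → ∃ λ b → a * b ≈ 1#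
    inverse = proj₂ F-isField

  *-nonzero : ∀ {x y} → ¬ x ≈ 0# → ¬ y ≈ 0# → ¬ x * y ≈ 0#
  *-nonzero {x} {y} x≉0 y≉0 xy≈0 with inverse x x≉0
  ... | x⁻¹ , xx⁻¹≈1 = y≉0 (begin
    y               ≈⟨ *-identityˡ y ⟨
    1# * y          ≈⟨ *-congʳ xx⁻¹≈1 ⟨
    (x * x⁻¹) * y   ≈⟨ xy∙z≈y∙xz x x⁻¹ y ⟩
    x⁻¹ * (x * y)   ≈⟨ *-congˡ xy≈0 ⟩
    x⁻¹ * 0#        ≈⟨ zeroʳ x⁻¹ ⟩
    0#              ∎)

  data DegreeView (p : Poly) : Set where
    zero-poly : p ≋ [] → DegreeView p
    degree    : ∀ d → ¬ coef p d ≈ 0# → DegreeBelow (suc d) p → DegreeView p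

  degreeView : ∀ p → DegreeView p
  degreeView []      = zero-poly ≋-refl
  degreeView (a ∷ p) with degreeView p
  ... | degree d lead≉0 deg = degree (suc d) lead≉0 λ { (suc n) (s≤s d<n) → deg n d<n }
  ... | zero-poly p≋[] with a ≈0?
  ...   | yes a≈0 = zero-poly (∷≋[] a≈0 p≋[])
  ...   | no  a≉0 = degree 0 a≉0 λ { (suc n) _ → at p≋[] n }

  coef≉0⇒< : ∀ p {d k} → ¬ coef p d ≈ 0# → DegreeBelow k p → d < k
  coef≉0⇒< p {d} {k} c≉0 deg with ℕ.≤-<-connex k d
  ... | inj₁ k≤d = ⊥-elim (c≉0 (deg d k≤d))
  ... | inj₂ d<k = d<k

  nonconstant⇒degree≥1 : ∀ {p d} → ¬ IsConstant p → DegreeBelow (suc d) p → 1 ≤ d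
  nonconstant⇒degree≥1 {d = zero}  nonconst deg = ⊥-elim (nonconst deg)
  nonconstant⇒degree≥1 {d = suc d} nonconst deg = s≤s z≤n

  isConstant? : ∀ p → Dec (IsConstant p)
  isConstant? []      = yes λ _ _ → refl
  isConstant? (a ∷ p) with degreeView p
  ... | zero-poly p≋[]  = yes λ { (suc n) _ → at p≋[] n }
  ... | degree d c≉0 _ = no λ const → c≉0 (const (suc d) (s≤s z≤n))

  IsConstant⇒∣one⊎≋[] : ∀ {c} → IsConstant c → c ∣ one ⊎ c ≋ []
  IsConstant⇒∣one⊎≋[] {c} const with coef c 0 ≈0?
  ... | yes c₀≈0 = inj₂ (≋-trans (IsConstant⇒≋[coef0] const) (∷≋[] c₀≈0 ≋-refl))
  ... | no  c₀≉0 with inverse (coef c 0) c₀≉0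
  ...   | c₀⁻¹ , c₀c₀⁻¹≈1 = inj₁ ([ c₀⁻¹ ] , ≋-trans (⊗-congʳ [ c₀⁻¹ ] (IsConstant⇒≋[coef0] const))
                                   (∷-cong (trans (+-identityʳ _) (trans (*-comm _ _) c₀c₀⁻¹≈1)) ≋-refl))

  [c]∣one : ∀ {c} → ¬ c ≈ 0# → [ c ] ∣ one
  [c]∣one {c} c≉0 with IsConstant⇒∣one⊎≋[] {[ c ]} (λ { (suc n) _ → refl })
  ... | inj₁ [c]∣one = [c]∣one
  ... | inj₂ [c]≋[]  = ⊥-elim (c≉0 (proj₁ (∷≋[]⁻¹ [c]≋[])))

  ∣one⇒IsConstant : ∀ {q} → q ∣ one → IsConstant q
  ∣one⇒IsConstant {q} (r , rq≋1) with degreeView r | degreeView q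
  ... | zero-poly r≋[] | _ = ⊥-elim (1≉0 (trans (sym (at rq≋1 0)) (at (≋[]⇒⊗≋[] q r≋[]) 0)))
  ... | degree _ _ _ | zero-poly q≋[] = ≋[]⇒IsConstant q≋[]
  ... | degree dr lr≉0 degR | degree zero lq≉0 degQ = degQ
  ... | degree dr lr≉0 degR | degree (suc dq) lq≉0 degQ =
    ⊥-elim (*-nonzero lr≉0 lq≉0 (begin
      coef r dr * coef q (suc dq)      ≈⟨ proj₂ (leading-⊗ r q dr (suc dq) degR degQ) ⟨
      coef (r ⊗ q) (dr ℕ.+ suc dq)     ≈⟨ at rq≋1 (dr ℕ.+ suc dq) ⟩
      coef one (dr ℕ.+ suc dq)         ≡⟨ ≡.cong (coef one) (ℕ.+-suc dr dq) ⟩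
      coef one (suc (dr ℕ.+ dq))       ∎))

  ∣nonzero-constant⇒IsConstant : ∀ {q c} → ¬ c ≈ 0# → q ∣ [ c ] → IsConstant q
  ∣nonzero-constant⇒IsConstant c≉0 q∣[c] = ∣one⇒IsConstant (∣-trans q∣[c] ([c]∣one c≉0))

  -- From a = s b + r one gets c ∷ a = (0 ∷ s) b + (c ∷ r); subtracting k b, with k chosen
  -- to cancel the coefficient of c ∷ r in degree db, restores the degree bound.
  divMod : ∀ {b} db → ¬ coef b db ≈ 0# → DegreeBelow (suc db) b → ∀ a →
           ∃ λ s → ∃ λ r → a ≋ s ⊗ b ⊕ r × DegreeBelow db r
  divMod db lb≉0 degB [] = [] , [] , ≋-refl , λ _ _ → refl
  divMod {b} db lb≉0 degB (c ∷ a) with divMod db lb≉0 degB a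
  ... | s , r , a≋sb+r , degR = k ∷ s , r′ , eq , degR′
    where
    lb lb⁻¹ t k : Carrier
    lb = coef b db
    lb⁻¹ = proj₁ (inverse lb lb≉0)
    t = coef (c ∷ r) db
    k = t * lb⁻¹
    r′ : Poly
    r′ = (c ∷ r) ⊕ ⊝ (k · b)

    eq : (c ∷ a) ≋ (k ∷ s) ⊗ b ⊕ r′
    eq = ≋-trans (∷-cong (sym (+-identityˡ c)) a≋sb+r)
      (solve 3 (λ kb sb cr → sb :+ cr := (kb :+ sb) :+ (cr :+ :- kb)) ≋-refl (k · b) (0# ∷ s ⊗ b) (c ∷ r))

    coef-r′ : ∀ n → coef r′ n ≈ coef (c ∷ r) n - k * coef b n
    coef-r′ n = trans (coef-⊕ (c ∷ r) (⊝ (k · b)) n) (+-congˡ (trans (coef-⊝ (k · b) n) (-‿cong (coef-· k b n))))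

    k*lb≈t : k * lb ≈ t
    k*lb≈t = begin
      (t * lb⁻¹) * lb ≈⟨ *-assoc t lb⁻¹ lb ⟩
      t * (lb⁻¹ * lb) ≈⟨ *-congˡ (trans (*-comm lb⁻¹ lb) (proj₂ (inverse lb lb≉0))) ⟩
      t * 1#          ≈⟨ *-identityʳ t ⟩
      t               ∎

    degR′ : DegreeBelow db r′
    degR′ n db≤n with ℕ.m≤n⇒m<n∨m≡n db≤n
    ... | inj₂ ≡.refl = trans (coef-r′ db) (trans (+-congˡ (-‿cong k*lb≈t)) (-‿inverseʳ t))
    ... | inj₁ db<n   = trans (coef-r′ n) (trans
      (+-cong (degR-∷ n db<n) (-‿cong (trans (*-congˡ (degB n db<n)) (zeroʳ k))))
      (trans (+-identityˡ _) -0#≈0#))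
      where
      degR-∷ : DegreeBelow (suc db) (c ∷ r)
      degR-∷ (suc m) (s≤s db≤m) = degR m db≤m

  record Bézout (a b : Poly) : Set where
    field
      gcd u v  : Poly
      identity : u ⊗ a ⊕ v ⊗ b ≋ gcd
      gcd∣a    : gcd ∣ a
      gcd∣b    : gcd ∣ b

  private
    bézout-[] : ∀ a {b} → b ≋ [] → Bézout a b
    bézout-[] a b≋[] = record
      { gcd = a ; u = one ; v = []
      ; identity = ≋-trans (⊕-identityʳ _) (⊗-identityˡ a)
      ; gcd∣a = ∣-refl a ; gcd∣b = ∣-respʳ (≋-sym b≋[]) (a ∣[]) }

    euclid : ∀ n a b → DegreeBelow n b → Bézout a b
    euclid zero    a b degB = bézout-[] a (mk≋ λ m → degB m z≤n)
    euclid (suc n) a b degB with degreeView b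
    ... | zero-poly b≋[] = bézout-[] a b≋[]
    ... | degree db lb≉0 degB′ with divMod db lb≉0 degB′ a
    ...   | s , r , a≋sb+r , degR = record
      { gcd = gcd ; u = v ; v = u ⊕ ⊝ (v ⊗ s)
      ; identity = ≋-trans (⊕-cong (⊗-congʳ v a≋sb+r) ≋-refl) (≋-trans
          (solve 5 (λ v s b r u → v :* (s :* b :+ r) :+ (u :+ :- (v :* s)) :* b := u :* b :+ v :* r)
                 ≋-refl v s b r u)
          identity)
      ; gcd∣a = ∣-respʳ (≋-sym a≋sb+r) (∣m∣n⇒∣m⊕n (∣n⇒∣m⊗n s gcd∣a) gcd∣b)
      ; gcd∣b = gcd∣a }
      where
      db≤n : db ≤ n
      db≤n = ℕ.≤-pred (coef≉0⇒< b lb≉0 degB)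
      open Bézout (euclid n b r (DegreeBelow-mono {p = r} db≤n degR))

  bézout : ∀ a b → Bézout a b
  bézout a b = euclid (length b) a b (DegreeBelow-length b)

  Coprime : Poly → Poly → Set
  Coprime p a = ∃ λ u → ∃ λ v → u ⊗ p ⊕ v ⊗ a ≋ one

  irreducible⇒∣⊎coprime : ∀ {q} → ¬ IsConstant q → IsIrreducible q → ∀ a → q ∣ a ⊎ Coprime q a
  irreducible⇒∣⊎coprime {q} nonconst irreducible a with bézout q a
  ... | G with Bézout.gcd∣a G
  ...   | r , rd≋q with irreducible r (Bézout.gcd G) (≋-sym rd≋q)
  ...     | inj₁ r-const = case-r (IsConstant⇒∣one⊎≋[] r-const)
    where
    open Bézout G
    case-r : r ∣ one ⊎ r ≋ [] → q ∣ a ⊎ Coprime q a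
    case-r (inj₂ r≋[]) = ⊥-elim (nonconst (≋[]⇒IsConstant (≋-trans (≋-sym rd≋q) (≋[]⇒⊗≋[] gcd r≋[]))))
    case-r (inj₁ (w , wr≋1)) = inj₁ (∣-trans (w , w⊗q≋gcd) gcd∣b)
      where
      w⊗q≋gcd : w ⊗ q ≋ gcd
      w⊗q≋gcd = ≋-trans (⊗-congʳ w (≋-sym rd≋q)) (≋-trans (≋-sym (⊗-assoc w r gcd))
                  (≋-trans (⊗-congˡ gcd wr≋1) (⊗-identityˡ gcd)))
  ...     | inj₂ d-const = case-d (IsConstant⇒∣one⊎≋[] d-const)
    where
    open Bézout G
    case-d : gcd ∣ one ⊎ gcd ≋ [] → q ∣ a ⊎ Coprime q a
    case-d (inj₂ d≋[]) =
      ⊥-elim (nonconst (≋[]⇒IsConstant (≋-trans (≋-sym rd≋q) (≋-trans (⊗-congʳ r d≋[]) (⊗-zeroʳ r)))))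
    case-d (inj₁ (w , wd≋1)) = inj₂ (w ⊗ u , w ⊗ v , ≋-trans
      (solve 5 (λ w u q v a → (w :* u) :* q :+ (w :* v) :* a := w :* (u :* q :+ v :* a)) ≋-refl w u q v a)
      (≋-trans (⊗-congʳ w identity) wd≋1))

  irreducible⇒prime : ∀ {q} → ¬ IsConstant q → IsIrreducible q → ∀ a b → q ∣ a ⊗ b → q ∣ a ⊎ q ∣ b
  irreducible⇒prime {q} nonconst irreducible a b q∣ab with irreducible⇒∣⊎coprime nonconst irreducible a
  ... | inj₁ q∣a = inj₁ q∣a
  ... | inj₂ (u , v , uq+va≋1) = inj₂ (∣-respʳ ubq+vab≋b (∣m∣n⇒∣m⊕n (n∣m⊗n (u ⊗ b) q) (∣n⇒∣m⊗n v q∣ab)))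
    where
    ubq+vab≋b : (u ⊗ b) ⊗ q ⊕ v ⊗ (a ⊗ b) ≋ b
    ubq+vab≋b = ≋-trans
      (solve 5 (λ u b q v a → (u :* b) :* q :+ v :* (a :* b) := (u :* q :+ v :* a) :* b) ≋-refl u b q v a)
      (≋-trans (⊗-congˡ b uq+va≋1) (⊗-identityˡ b))

  irreducible∣∏ : ∀ {p} → ¬ IsConstant p → IsIrreducible p → ∀ qs → p ∣ ∏ qs → ∃ λ q → q ∈ qs × p ∣ q
  irreducible∣∏ nonconst irreducible []       p∣1 = ⊥-elim (nonconst (∣one⇒IsConstant p∣1))
  irreducible∣∏ nonconst irreducible (q ∷ qs) p∣q∏qs
    with irreducible⇒prime nonconst irreducible q (∏ qs) p∣q∏qs
  ... | inj₁ p∣q   = q , here ≡.refl , p∣q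
  ... | inj₂ p∣∏qs with irreducible∣∏ nonconst irreducible qs p∣∏qs
  ...   | q′ , q′∈qs , p∣q′ = q′ , there q′∈qs , p∣q′

  irreducible∣^ : ∀ {p} → ¬ IsConstant p → IsIrreducible p → ∀ q n → p ∣ q ^ n → p ∣ q
  irreducible∣^ nonconst irreducible q zero    p∣1 = ⊥-elim (nonconst (∣one⇒IsConstant p∣1))
  irreducible∣^ nonconst irreducible q (suc n) p∣qqⁿ
    with irreducible⇒prime nonconst irreducible q (q ^ n) p∣qqⁿ
  ... | inj₁ p∣q  = p∣q
  ... | inj₂ p∣qⁿ = irreducible∣^ nonconst irreducible q n p∣qⁿ

  proper-factor-DegreeBelow : ∀ {n q} a b → q ≋ a ⊗ b → DegreeBelow (suc n) q →
                         ¬ IsConstant a → ¬ IsConstant b → DegreeBelow n a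
  proper-factor-DegreeBelow {n} {q} a b q≋ab degQ a-nonconst b-nonconst with degreeView a | degreeView b
  ... | zero-poly a≋[] | _              = ⊥-elim (a-nonconst (≋[]⇒IsConstant a≋[]))
  ... | degree _ _ _   | zero-poly b≋[] = ⊥-elim (b-nonconst (≋[]⇒IsConstant b≋[]))
  ... | degree da la≉0 degA | degree db lb≉0 degB = DegreeBelow-mono {p = a} da<n degA
    where
    lq≈la*lb : coef q (da ℕ.+ db) ≈ coef a da * coef b db
    lq≈la*lb = trans (at q≋ab _) (proj₂ (leading-⊗ a b da db degA degB))
    da+db<1+n : da ℕ.+ db < suc n
    da+db<1+n = coef≉0⇒< q (λ lq≈0 → *-nonzero la≉0 lb≉0 (trans (sym lq≈la*lb) lq≈0)) degQ
    da<n : da < n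
    da<n = ℕ.<-≤-trans (ℕ.m<m+n da (nonconstant⇒degree≥1 {b} b-nonconst degB)) (ℕ.≤-pred da+db<1+n)

  IrreducibleFactor : Poly → Set
  IrreducibleFactor q = ∃ λ p → ¬ IsConstant p × IsIrreducible p × p ∣ q

  -- Constructively only the double negation is available: if q had no irreducible
  -- factor, q itself would be irreducible, as a splitting into nonconstant factors
  -- yields a factor of smaller degree.
  ¬¬irreducible-factor : ∀ {q} → ¬ IsConstant q → ¬ ¬ IrreducibleFactor q
  ¬¬irreducible-factor {q} = descend (length q) q (DegreeBelow-length q)
    where
    descend : ∀ n p → DegreeBelow n p → ¬ IsConstant p → ¬ ¬ IrreducibleFactor p
    descend zero    p degP nonconst _         = nonconst (DegreeBelow-mono {p = p} z≤n degP)
    descend (suc n) p degP nonconst no-factor = no-factor (p , nonconst , irreducible , ∣-refl p)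
      where
      irreducible : IsIrreducible p
      irreducible a b p≋ab with isConstant? a | isConstant? b
      ... | yes a-const     | _             = inj₁ a-const
      ... | no _            | yes b-const   = inj₂ b-const
      ... | no a-nonconst   | no b-nonconst = ⊥-elim
        (descend n a (proper-factor-DegreeBelow a b p≋ab degP a-nonconst b-nonconst) a-nonconst
          λ { (r , r-nonconst , r-irreducible , r∣a) → no-factor
                (r , r-nonconst , r-irreducible , ∣-trans r∣a (b , ≋-trans (⊗-comm b a) (≋-sym p≋ab))) })

  monic-associates⇒≋ : ∀ {p q c} → IsMonic p → IsMonic q → q ≋ [ c ] ⊗ p → q ≋ p
  monic-associates⇒≋ {p} {q} {c} (dp , lp≈1 , degP) (dq , lq≈1 , degQ) q≋cp =
    ≋-trans q≋cp (≋-trans (⊗-congˡ p (∷-cong c≈1 (≋-refl {[]}))) (⊗-identityˡ p))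
    where
    coef-q : ∀ n → coef q n ≈ c * coef p n
    coef-q n = trans (at q≋cp n) (coef-[]⊗ c p n)
    c≈coef-q-dp : c ≈ coef q dp
    c≈coef-q-dp = trans (sym (*-identityʳ c)) (trans (*-congˡ (sym lp≈1)) (sym (coef-q dp)))
    c≈1 : c ≈ 1#
    c≈1 with ℕ.<-cmp dp dq
    ... | tri≈ _ ≡.refl _ = trans c≈coef-q-dp lq≈1
    ... | tri< dp<dq _ _  = ⊥-elim (1≉0 (trans (sym lq≈1) (trans (coef-q dq) (trans (*-congˡ (degP dq dp<dq)) (zeroʳ c)))))
    ... | tri> _ _ dq<dp  = ⊥-elim (1≉0 (trans (sym lq≈1) (trans (coef-q dq) (trans (*-congʳ c≈0) (zeroˡ _)))))
      where
      c≈0 : c ≈ 0#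
      c≈0 = trans c≈coef-q-dp (degQ dp dq<dp)

  monic∣monic-irreducible⇒≋ : ∀ {p q} → IsMonic p → ¬ IsConstant p → IsMonic q → IsIrreducible q → p ∣ q → p ≋ q
  monic∣monic-irreducible⇒≋ {p} {q} p-monic p-nonconst q-monic q-irreducible (r , rp≋q)
    with q-irreducible r p (≋-sym rp≋q)
  ... | inj₂ p-const = ⊥-elim (p-nonconst p-const)
  ... | inj₁ r-const = ≋-sym (monic-associates⇒≋ p-monic q-monic
                          (≋-trans (≋-sym rp≋q) (⊗-congˡ p (IsConstant⇒≋[coef0] {r} r-const))))

  module Quotient {q} (q-nonconst : ¬ IsConstant q) (q-irreducible : IsIrreducible q) where

    infix 4 _≈q_
    record _≈q_ (a b : Poly) : Set where
      constructor mk≈q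
      field q∣a-b : q ∣ a ⊕ ⊝ b
    open _≈q_

    ≋⇒≈q : ∀ {a b} → a ≋ b → a ≈q b
    ≋⇒≈q {a} {b} a≋b = mk≈q (∣-respʳ (≋-sym (≋-trans (⊕-cong a≋b ≋-refl) (⊕-inverseʳ b))) (q ∣[]))

    private
      ≈q-sym : ∀ {a b} → a ≈q b → b ≈q a
      ≈q-sym {a} {b} (mk≈q d) = mk≈q (∣-respʳ (solve 2 (λ a b → :- (a :+ :- b) := b :+ :- a) ≋-refl a b) (∣n⇒∣⊝n d))

      ≈q-trans : ∀ {a b c} → a ≈q b → b ≈q c → a ≈q c
      ≈q-trans {a} {b} {c} (mk≈q d) (mk≈q d′) =
        mk≈q (∣-respʳ (solve 3 (λ a b c → (a :+ :- b) :+ (b :+ :- c) := a :+ :- c) ≋-refl a b c) (∣m∣n⇒∣m⊕n d d′))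

      ⊕-cong-≈q : ∀ {a a′ b b′} → a ≈q a′ → b ≈q b′ → a ⊕ b ≈q a′ ⊕ b′
      ⊕-cong-≈q {a} {a′} {b} {b′} (mk≈q d) (mk≈q d′) = mk≈q (∣-respʳ
        (solve 4 (λ a a′ b b′ → (a :+ :- a′) :+ (b :+ :- b′) := (a :+ b) :+ :- (a′ :+ b′)) ≋-refl a a′ b b′)
        (∣m∣n⇒∣m⊕n d d′))

      ⊗-cong-≈q : ∀ {a a′ b b′} → a ≈q a′ → b ≈q b′ → a ⊗ b ≈q a′ ⊗ b′
      ⊗-cong-≈q {a} {a′} {b} {b′} (mk≈q d) (mk≈q d′) = mk≈q (∣-respʳ
        (solve 4 (λ a a′ b b′ → (a :+ :- a′) :* b :+ a′ :* (b :+ :- b′) := a :* b :+ :- (a′ :* b′)) ≋-refl a a′ b b′)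
        (∣m∣n⇒∣m⊕n (∣m⇒∣m⊗n b d) (∣n⇒∣m⊗n a′ d′)))

      ⊝-cong-≈q : ∀ {a a′} → a ≈q a′ → ⊝ a ≈q ⊝ a′
      ⊝-cong-≈q {a} {a′} (mk≈q d) =
        mk≈q (∣-respʳ (solve 2 (λ a a′ → :- (a :+ :- a′) := :- a :+ :- (:- a′)) ≋-refl a a′) (∣n⇒∣⊝n d))

    commutativeRing : CommutativeRing 0ℓ 0ℓ
    commutativeRing = record
      { Carrier = Poly ; _≈_ = _≈q_ ; _+_ = _⊕_ ; _*_ = _⊗_ ; -_ = ⊝_ ; 0# = [] ; 1# = one
      ; isCommutativeRing = record
        { isRing = record
          { +-isAbelianGroup = record
            { isGroup = record
              { isMonoid = record
                { isSemigroup = record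
                  { isMagma = record
                    { isEquivalence = record { refl = ≋⇒≈q ≋-refl ; sym = ≈q-sym ; trans = ≈q-trans }
                    ; ∙-cong = ⊕-cong-≈q }
                  ; assoc = λ a b c → ≋⇒≈q (⊕-assoc a b c) }
                ; identity = (λ a → ≋⇒≈q ≋-refl) , (λ a → ≋⇒≈q (⊕-identityʳ a)) }
              ; inverse = (λ a → ≋⇒≈q (⊕-inverseˡ a)) , (λ a → ≋⇒≈q (⊕-inverseʳ a))
              ; ⁻¹-cong = ⊝-cong-≈q }
            ; comm = λ a b → ≋⇒≈q (⊕-comm a b) }
          ; *-cong = ⊗-cong-≈q
          ; *-assoc = λ a b c → ≋⇒≈q (⊗-assoc a b c)
          ; *-identity = (λ a → ≋⇒≈q (⊗-identityˡ a)) , (λ a → ≋⇒≈q (⊗-identityʳ a))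
          ; distrib = (λ a b c → ≋⇒≈q (⊗-distribˡ a b c)) , (λ c a b → ≋⇒≈q (⊗-distribʳ a b c)) }
        ; *-comm = λ a b → ≋⇒≈q (⊗-comm a b) } }

    isField : IsField commutativeRing
    isField = (λ (mk≈q q∣one) → q-nonconst (∣one⇒IsConstant q∣one)) , inverse-≈q
      where
      inverse-≈q : ∀ a → ¬ a ≈q [] → ∃ λ b → a ⊗ b ≈q one
      inverse-≈q a a≉0 with irreducible⇒∣⊎coprime q-nonconst q-irreducible a
      ... | inj₁ q∣a = ⊥-elim (a≉0 (mk≈q (∣-respʳ (≋-sym (⊕-identityʳ a)) q∣a)))
      ... | inj₂ (u , v , uq+va≋1) = v , mk≈q (∣-respʳ
        (≋-trans (solve 4 (λ u q v a → :- (u :* q) := a :* v :+ :- (u :* q :+ v :* a)) ≋-refl u q v a)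
                 (⊕-cong ≋-refl (⊝-cong uq+va≋1)))
        (∣n⇒∣⊝n (n∣m⊗n u q)))

    X : Poly
    X = 0# ∷ one

    private
      natK-≈q : ∀ n → natK commutativeRing n ≈q [ natK F n ]
      natK-≈q zero    = ≋⇒≈q (≋-sym (∷≋[] refl ≋-refl))
      natK-≈q (suc n) = ⊕-cong-≈q (≋⇒≈q ≋-refl) (natK-≈q n)

      intK-≈q : ∀ c → intK commutativeRing c ≈q [ intK F c ]
      intK-≈q (+ n)    = natK-≈q n
      intK-≈q -[1+ n ] = ⊝-cong-≈q (natK-≈q (suc n))

    HasChar-lift : ∀ {ℓ} → HasChar F ℓ → HasChar commutativeRing ℓ
    HasChar-lift {ℓ} χ = ≈q-trans (natK-≈q ℓ) (≋⇒≈q (∷≋[] χ ≋-refl))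

    evalℤ-X : ∀ f → evalℤ commutativeRing f X ≈q map (intK F) f
    evalℤ-X []      = ≋⇒≈q ≋-refl
    evalℤ-X (c ∷ f) = ≈q-trans (⊕-cong-≈q (intK-≈q c) (⊗-cong-≈q (≋⇒≈q (≋-refl {X})) (evalℤ-X f)))
                               (≋⇒≈q ([a]⊕X⊗p (intK F c) (map (intK F) f)))
      where
      [a]⊕X⊗p : ∀ a p → [ a ] ⊕ X ⊗ p ≋ (a ∷ p)
      [a]⊕X⊗p a p = ≋-trans (⊕-cong (≋-refl {[ a ]}) (⊕-cong (·-zeroˡ p) (∷-cong refl (⊗-identityˡ p))))
                            (∷-cong (+-identityʳ a) (≋-refl {p}))

    root-X⇒∣ : ∀ f → evalℤ commutativeRing f X ≈q [] → q ∣ map (intK F) f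
    root-X⇒∣ f root = ∣-respʳ (⊕-identityʳ _) (q∣a-b (≈q-trans (≈q-sym (evalℤ-X f)) root))

    ∣⇒root-X : ∀ f → q ∣ map (intK F) f → evalℤ commutativeRing f X ≈q []
    ∣⇒root-X f q∣f = ≈q-trans (evalℤ-X f) (mk≈q (∣-respʳ (≋-sym (⊕-identityʳ _)) q∣f))

module ℤ[x] = Polynomial ℤ.+-*-commutativeRing

RootsIncludedInChar : ℕ → Polyℤ → Polyℤ → Set₁
RootsIncludedInChar ℓ f g = (K : CommutativeRing 0ℓ 0ℓ) → IsField K → HasChar K ℓ →
  ∀ x → CommutativeRing._≈_ K (evalℤ K f x) (CommutativeRing.0# K) →
        CommutativeRing._≈_ K (evalℤ K g x) (CommutativeRing.0# K)

module Reduction (F : CommutativeRing 0ℓ 0ℓ) (F-isField : IsField F)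
  (_≈0? : ∀ a → Dec (CommutativeRing._≈_ F a (CommutativeRing.0# F))) where
  open CommutativeRing F hiding (zero)
  open Polynomial F
  open PolynomialOverField F F-isField _≈0?
  private
    module ℤ→F = PolynomialMap ℤ.+-*-commutativeRing F (IntegerCoefficients.intK-isNearSemiringHomomorphism F)

  reduce : Polyℤ → Poly
  reduce = map (intK F)

  coef-reduce : ∀ P n → coef (reduce P) n ≈ intK F (ℤ[x].coef P n)
  coef-reduce = ℤ→F.coef-map

  divisor-coprime-to-g-reduces-to-constant :
    ∀ {ℓ f g} → HasChar F ℓ → RootsIncludedInChar ℓ f g →
    ∀ {P H A B c₁ c₂} → H ℤ[x].⊗ P ℤ[x].≋ [ c₁ ] ℤ[x].⊗ f → A ℤ[x].⊗ P ℤ[x].⊕ B ℤ[x].⊗ g ℤ[x].≋ [ c₂ ] →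
    ¬ intK F c₁ ≈ 0# → ¬ intK F c₂ ≈ 0# → IsConstant (reduce P)
  divisor-coprime-to-g-reduces-to-constant {ℓ} {f} {g} χ roots {P} {H} {A} {B} {c₁} {c₂} HP≋c₁f AP+Bg≋c₂ c₁≉0 c₂≉0
    with isConstant? (reduce P)
  ... | yes P̄-const    = P̄-const
  ... | no  P̄-nonconst = ⊥-elim (¬¬irreducible-factor P̄-nonconst
    λ (q , q-nonconst , q-irreducible , q∣P̄) → q-nonconst (q-constant q-nonconst q-irreducible q∣P̄))
    where
    q-constant : ∀ {q} → ¬ IsConstant q → IsIrreducible q → q ∣ reduce P → IsConstant q
    q-constant {q} q-nonconst q-irreducible q∣P̄ = ∣nonzero-constant⇒IsConstant c₂≉0 q∣c̄₂
      where
      open Quotient q-nonconst q-irreducible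
      q∣f̄ : q ∣ reduce f
      q∣f̄ = ∣-cancel-unit ([c]∣one c₁≉0) (∣-respʳ
        (≋-trans (≋-sym (ℤ→F.map-⊗ H P)) (≋-trans (ℤ→F.map-cong HP≋c₁f) (ℤ→F.map-⊗ [ c₁ ] f)))
        (∣n⇒∣m⊗n (reduce H) q∣P̄))
      q∣ḡ : q ∣ reduce g
      q∣ḡ = root-X⇒∣ g (roots commutativeRing isField (HasChar-lift {ℓ} χ) X (∣⇒root-X f q∣f̄))
      q∣c̄₂ : q ∣ [ intK F c₂ ]
      q∣c̄₂ = ∣-respʳ
        (≋-trans (≋-sym (⊕-cong (ℤ→F.map-⊗ A P) (ℤ→F.map-⊗ B g)))
                 (≋-trans (≋-sym (ℤ→F.map-⊕ (A ℤ[x].⊗ P) (B ℤ[x].⊗ g))) (ℤ→F.map-cong AP+Bg≋c₂)))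
        (∣m∣n⇒∣m⊕n (∣n⇒∣m⊗n (reduce A) q∣P̄) (∣n⇒∣m⊗n (reduce B) q∣ḡ))

module IntegersModPrime (ℓ : ℕ) (ℓ-prime : Prime ℓ) where
  open import Data.Integer.Divisibility.Signed as ℤ∣ using (divides) renaming (_∣_ to _∣ℤ_)
  import Data.Nat.Divisibility as ℕ∣
  open import Data.Nat.Coprimality using (Coprime; coprime-Bézout)
  open import Data.Nat.GCD using (module Bézout)
  open import Data.Nat.Primality using (prime⇒irreducible; prime⇒nonTrivial)
  open import Data.Integer.Solver using (module +-*-Solver)
  open +-*-Solver
  open ≡ using (refl; cong; sym; trans)

  infix 4 _≡ₘ_
  record _≡ₘ_ (a b : ℤ) : Set where
    constructor mk≡ₘ
    field ℓ∣a-b : + ℓ ∣ℤ a ℤ.- b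
  open _≡ₘ_

  private
    ℓ∣-resp : ∀ {a b} → a ≡ b → + ℓ ∣ℤ a → + ℓ ∣ℤ b
    ℓ∣-resp refl ℓ∣a = ℓ∣a

  ≡⇒≡ₘ : ∀ {a b} → a ≡ b → a ≡ₘ b
  ≡⇒≡ₘ {a} refl = mk≡ₘ (ℓ∣-resp (sym (ℤ.+-inverseʳ a)) (divides 0ℤ refl))

  private
    ≡ₘ-sym : ∀ {a b} → a ≡ₘ b → b ≡ₘ a
    ≡ₘ-sym {a} {b} (mk≡ₘ d) = mk≡ₘ (ℓ∣-resp (solve 2 (λ a b → :- (a :- b) := b :- a) refl a b) (ℤ∣.∣m⇒∣-m d))

    ≡ₘ-trans : ∀ {a b c} → a ≡ₘ b → b ≡ₘ c → a ≡ₘ c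
    ≡ₘ-trans {a} {b} {c} (mk≡ₘ d) (mk≡ₘ d′) =
      mk≡ₘ (ℓ∣-resp (solve 3 (λ a b c → (a :- b) :+ (b :- c) := a :- c) refl a b c) (ℤ∣.∣m∣n⇒∣m+n d d′))

    +-cong-≡ₘ : ∀ {a a′ b b′} → a ≡ₘ a′ → b ≡ₘ b′ → a ℤ.+ b ≡ₘ a′ ℤ.+ b′
    +-cong-≡ₘ {a} {a′} {b} {b′} (mk≡ₘ d) (mk≡ₘ d′) = mk≡ₘ (ℓ∣-resp
      (solve 4 (λ a a′ b b′ → (a :- a′) :+ (b :- b′) := (a :+ b) :- (a′ :+ b′)) refl a a′ b b′)
      (ℤ∣.∣m∣n⇒∣m+n d d′))

    *-cong-≡ₘ : ∀ {a a′ b b′} → a ≡ₘ a′ → b ≡ₘ b′ → a ℤ.* b ≡ₘ a′ ℤ.* b′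
    *-cong-≡ₘ {a} {a′} {b} {b′} (mk≡ₘ d) (mk≡ₘ d′) = mk≡ₘ (ℓ∣-resp
      (solve 4 (λ a a′ b b′ → (a :- a′) :* b :+ a′ :* (b :- b′) := (a :* b) :- (a′ :* b′)) refl a a′ b b′)
      (ℤ∣.∣m∣n⇒∣m+n (ℤ∣.∣m⇒∣m*n b d) (ℤ∣.∣n⇒∣m*n a′ d′)))

    neg-cong-≡ₘ : ∀ {a a′} → a ≡ₘ a′ → ℤ.- a ≡ₘ ℤ.- a′
    neg-cong-≡ₘ {a} {a′} (mk≡ₘ d) =
      mk≡ₘ (ℓ∣-resp (solve 2 (λ a a′ → :- (a :- a′) := (:- a) :- (:- a′)) refl a a′) (ℤ∣.∣m⇒∣-m d))

  commutativeRing : CommutativeRing 0ℓ 0ℓ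
  commutativeRing = record
    { Carrier = ℤ ; _≈_ = _≡ₘ_ ; _+_ = ℤ._+_ ; _*_ = ℤ._*_ ; -_ = ℤ.-_ ; 0# = 0ℤ ; 1# = 1ℤ
    ; isCommutativeRing = record
      { isRing = record
        { +-isAbelianGroup = record
          { isGroup = record
            { isMonoid = record
              { isSemigroup = record
                { isMagma = record
                  { isEquivalence = record { refl = ≡⇒≡ₘ refl ; sym = ≡ₘ-sym ; trans = ≡ₘ-trans }
                  ; ∙-cong = +-cong-≡ₘ }
                ; assoc = λ a b c → ≡⇒≡ₘ (ℤ.+-assoc a b c) }
              ; identity = (λ a → ≡⇒≡ₘ (ℤ.+-identityˡ a)) , (λ a → ≡⇒≡ₘ (ℤ.+-identityʳ a)) }
            ; inverse = (λ a → ≡⇒≡ₘ (ℤ.+-inverseˡ a)) , (λ a → ≡⇒≡ₘ (ℤ.+-inverseʳ a))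
            ; ⁻¹-cong = neg-cong-≡ₘ }
          ; comm = λ a b → ≡⇒≡ₘ (ℤ.+-comm a b) }
        ; *-cong = *-cong-≡ₘ
        ; *-assoc = λ a b c → ≡⇒≡ₘ (ℤ.*-assoc a b c)
        ; *-identity = (λ a → ≡⇒≡ₘ (ℤ.*-identityˡ a)) , (λ a → ≡⇒≡ₘ (ℤ.*-identityʳ a))
        ; distrib = (λ a b c → ≡⇒≡ₘ (ℤ.*-distribˡ-+ a b c)) , (λ a b c → ≡⇒≡ₘ (ℤ.*-distribʳ-+ a b c)) }
      ; *-comm = λ a b → ≡⇒≡ₘ (ℤ.*-comm a b) } }

  _≡ₘ0? : ∀ a → Dec (a ≡ₘ 0ℤ)
  a ≡ₘ0? with + ℓ ℤ∣.∣? (a ℤ.- 0ℤ)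
  ... | yes ℓ∣a = yes (mk≡ₘ ℓ∣a)
  ... | no  ℓ∤a = no λ (mk≡ₘ ℓ∣a) → ℓ∤a ℓ∣a

  private
    ℓ∣ℤ+⇒ℓ∣ : ∀ {m} → + m ≡ₘ 0ℤ → ℓ ℕ∣.∣ m
    ℓ∣ℤ+⇒ℓ∣ {m} (mk≡ₘ ℓ∣m) = ℤ∣.∣⇒∣ᵤ (ℓ∣-resp (ℤ.+-identityʳ (+ m)) ℓ∣m)

  0<m<ℓ⇒≢ₘ0 : ∀ {m} → 0 < m → m < ℓ → ¬ + m ≡ₘ 0ℤ
  0<m<ℓ⇒≢ₘ0 {m} 0<m m<ℓ m≡ₘ0 =
    ℕ.<⇒≱ m<ℓ (ℕ∣.∣⇒≤ {{ℕ.>-nonZero 0<m}} (ℓ∣ℤ+⇒ℓ∣ m≡ₘ0))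

  private
    ℓ∤⇒coprime : ∀ m → ¬ ℓ ℕ∣.∣ m → Coprime ℓ m
    ℓ∤⇒coprime m ℓ∤m (d∣ℓ , d∣m) with prime⇒irreducible ℓ-prime d∣ℓ
    ... | inj₁ d≡1 = d≡1
    ... | inj₂ refl = ⊥-elim (ℓ∤m d∣m)

    inverse⁺ : ∀ m → ¬ ℓ ℕ∣.∣ m → ∃ λ b → + m ℤ.* b ≡ₘ 1ℤ
    inverse⁺ m ℓ∤m with coprime-Bézout (ℓ∤⇒coprime m ℓ∤m)
    ... | Bézout.-+ x y 1+xℓ≡ym = + y , mk≡ₘ (divides (+ x) (begin
      + m ℤ.* + y ℤ.- 1ℤ          ≡⟨ cong (ℤ._- 1ℤ) (trans (ℤ.*-comm (+ m) (+ y)) (sym (ℤ.pos-* y m))) ⟩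
      + (y ℕ.* m) ℤ.- 1ℤ          ≡⟨ cong (λ k → + k ℤ.- 1ℤ) (sym 1+xℓ≡ym) ⟩
      + (1 ℕ.+ x ℕ.* ℓ) ℤ.- 1ℤ    ≡⟨ cong (ℤ._- 1ℤ) (trans (ℤ.pos-+ 1 (x ℕ.* ℓ)) (cong (λ k → 1ℤ ℤ.+ k) (ℤ.pos-* x ℓ))) ⟩
      1ℤ ℤ.+ + x ℤ.* + ℓ ℤ.- 1ℤ   ≡⟨ solve 1 (λ k → con 1ℤ :+ k :- con 1ℤ := k) refl (+ x ℤ.* + ℓ) ⟩
      + x ℤ.* + ℓ                 ∎))
      where open ≡.≡-Reasoning
    ... | Bézout.+- x y 1+ym≡xℓ = ℤ.- + y , mk≡ₘ (divides (ℤ.- + x) (begin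
      + m ℤ.* ℤ.- + y ℤ.- 1ℤ      ≡⟨ solve 2 (λ m y → m :* (:- y) :- con 1ℤ := :- (con 1ℤ :+ y :* m)) refl (+ m) (+ y) ⟩
      ℤ.- (1ℤ ℤ.+ + y ℤ.* + m)    ≡⟨ cong ℤ.-_ (trans (cong (λ k → 1ℤ ℤ.+ k) (sym (ℤ.pos-* y m))) (sym (ℤ.pos-+ 1 (y ℕ.* m)))) ⟩
      ℤ.- + (1 ℕ.+ y ℕ.* m)       ≡⟨ cong (λ k → ℤ.- + k) 1+ym≡xℓ ⟩
      ℤ.- + (x ℕ.* ℓ)             ≡⟨ cong ℤ.-_ (ℤ.pos-* x ℓ) ⟩
      ℤ.- (+ x ℤ.* + ℓ)           ≡⟨ ℤ.neg-distribˡ-* (+ x) (+ ℓ) ⟩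
      ℤ.- + x ℤ.* + ℓ             ∎))
      where open ≡.≡-Reasoning

    inverse : ∀ a → ¬ a ≡ₘ 0ℤ → ∃ λ b → a ℤ.* b ≡ₘ 1ℤ
    inverse (+ m) m≢0 = inverse⁺ m λ ℓ∣m →
      m≢0 (mk≡ₘ (ℓ∣-resp (sym (ℤ.+-identityʳ (+ m))) (ℤ∣.∣ᵤ⇒∣ ℓ∣m)))
    inverse -[1+ n ] -m≢0 =
      let (b , mb≡1) = inverse⁺ (suc n) ℓ∤m
      in ℤ.- b , ≡ₘ-trans (≡⇒≡ₘ (solve 2 (λ m b → (:- m) :* (:- b) := m :* b) refl (+ suc n) b)) mb≡1
      where
      ℓ∤m : ¬ ℓ ℕ∣.∣ suc n
      ℓ∤m ℓ∣m = -m≢0 (mk≡ₘ (ℓ∣-resp (sym (ℤ.+-identityʳ -[1+ n ])) (ℤ∣.∣m⇒∣-m (ℤ∣.∣ᵤ⇒∣ ℓ∣m))))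

  isField : IsField commutativeRing
  isField = 0<m<ℓ⇒≢ₘ0 (s≤s z≤n) (ℕ.nonTrivial⇒n>1 ℓ {{prime⇒nonTrivial ℓ-prime}}) , inverse

  natK≡id : ∀ n → natK commutativeRing n ≡ + n
  natK≡id zero    = refl
  natK≡id (suc n) = cong (λ k → 1ℤ ℤ.+ k) (natK≡id n)

  intK≡id : ∀ c → intK commutativeRing c ≡ c
  intK≡id (+ n)    = natK≡id n
  intK≡id -[1+ n ] = cong ℤ.-_ (natK≡id (suc n))

  hasChar : HasChar commutativeRing ℓ
  hasChar = ≡ₘ-trans (≡⇒≡ₘ (natK≡id ℓ)) (mk≡ₘ (ℓ∣-resp (sym (ℤ.+-identityʳ (+ ℓ))) ℤ∣.∣-refl))

ℚ-isField : IsField ℚ.+-*-commutativeRing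
ℚ-isField = (λ ()) , λ a a≢0 → ℚ.1/_ a {{ℚ.≢-nonZero a≢0}} , ℚ.*-inverseʳ a {{ℚ.≢-nonZero a≢0}}

module ℚ[x] where
  open Polynomial ℚ.+-*-commutativeRing public
  open PolynomialOverField ℚ.+-*-commutativeRing ℚ-isField (λ a → a ℚ.≟ 0ℚ) public

fromℤ : ℤ → ℚ
fromℤ i = i ℚ./ 1

private
  fromℤ≡mkℚ : ∀ i → fromℤ i ≡ ℚ.mkℚ i 0 (Coprimality.sym (Coprimality.1-coprimeTo ℤ.∣ i ∣))
  fromℤ≡mkℚ (+ n)    = ℚ.normalize-coprime (Coprimality.sym (Coprimality.1-coprimeTo n))
  fromℤ≡mkℚ -[1+ n ] = ≡.cong ℚ.-_ (ℚ.normalize-coprime (Coprimality.sym (Coprimality.1-coprimeTo (suc n))))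

fromℤ-+ : ∀ i j → fromℤ (i ℤ.+ j) ≡ fromℤ i ℚ.+ fromℤ j
fromℤ-+ i j rewrite fromℤ≡mkℚ i | fromℤ≡mkℚ j =
  ≡.cong (ℚ._/ 1) (≡.cong₂ ℤ._+_ (≡.sym (ℤ.*-identityʳ i)) (≡.sym (ℤ.*-identityʳ j)))

fromℤ-* : ∀ i j → fromℤ (i ℤ.* j) ≡ fromℤ i ℚ.* fromℤ j
fromℤ-* i j rewrite fromℤ≡mkℚ i | fromℤ≡mkℚ j = ≡.refl

fromℤ-injective : ∀ {i j} → fromℤ i ≡ fromℤ j → i ≡ j
fromℤ-injective {i} {j} eq = ≡.cong ℚ.↥_ (≡.trans (≡.sym (fromℤ≡mkℚ i)) (≡.trans eq (fromℤ≡mkℚ j)))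

denominator*q≡numerator : ∀ q → fromℤ (+ ℚ.↧ₙ q) ℚ.* q ≡ fromℤ (ℚ.↥ q)
denominator*q≡numerator (ℚ.mkℚ n d _) rewrite fromℤ≡mkℚ (+ suc d) =
  /-cong (+ suc d ℤ.* n) n (d ℕ.+ 0) 0 (≡.trans
    (solve 2 (λ d n → (d :* n) :* con (+ 1) := n :* d) ≡.refl (+ suc d) n)
    (≡.cong (λ k → n ℤ.* + suc k) (≡.sym (ℕ.+-identityʳ d))))
  where
  open import Data.Integer.Solver using (module +-*-Solver)
  open +-*-Solver
  /-cong : ∀ i j d e → i ℤ.* + suc e ≡ j ℤ.* + suc d → i ℚ./ suc d ≡ j ℚ./ suc e
  /-cong i j d e eq = ℚ.fromℚᵘ-cong {ℚᵘ.mkℚᵘ i d} {ℚᵘ.mkℚᵘ j e} (ℚᵘ.*≡* eq)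

fromℤ-isNearSemiringHomomorphism :
  NearSemiringMorphisms.IsNearSemiringHomomorphism ℤ.+-*-rawNearSemiring ℚ.+-*-rawNearSemiring fromℤ
fromℤ-isNearSemiringHomomorphism = record
  { +-isMonoidHomomorphism = record
    { isMagmaHomomorphism = record { isRelHomomorphism = record { cong = ≡.cong fromℤ } ; homo = fromℤ-+ }
    ; ε-homo = ≡.refl }
  ; *-homo = fromℤ-* }

module ℤ→ℚ = PolynomialMap ℤ.+-*-commutativeRing ℚ.+-*-commutativeRing fromℤ-isNearSemiringHomomorphism

private
  fromℤ-ℕ* : ∀ m n → fromℤ (+ (m ℕ.* n)) ≡ fromℤ (+ m) ℚ.* fromℤ (+ n)
  fromℤ-ℕ* m n = ≡.trans (≡.cong fromℤ (ℤ.pos-* m n)) (fromℤ-* (+ m) (+ n))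

  [ℕ*] : ∀ m n → [ fromℤ (+ (m ℕ.* n)) ] ℚ[x].≋ [ fromℤ (+ m) ] ℚ[x].⊗ [ fromℤ (+ n) ]
  [ℕ*] m n = ℚ[x].≋-sym (ℚ[x].≋-trans (ℚ[x].[]-⊗ (fromℤ (+ m)) [ fromℤ (+ n) ])
                                       (ℚ[x].∷-cong (≡.sym (fromℤ-ℕ* m n)) ℚ[x].≋-refl))

clear-denominators : ∀ p → ∃ λ d → ∃ λ P → 1 ≤ d × toℚ[x] P ℚ[x].≋ [ fromℤ (+ d) ] ℚ[x].⊗ p
clear-denominators []      = 1 , [] , s≤s z≤n , ℚ[x].≋-sym (ℚ[x].⊗-zeroʳ [ 1ℚ ])
clear-denominators (a ∷ p) with clear-denominators p
... | d , P , d≥1 , P≋dp =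
  ℚ.↧ₙ a ℕ.* d , (ℚ.↥ a ℤ.* + d) ∷ (+ ℚ.↧ₙ a) ℤ[x].· P , ℕ.*-mono-≤ {1} {ℚ.↧ₙ a} {1} {d} (s≤s z≤n) d≥1 ,
  ℚ[x].≋-trans (ℚ[x].∷-cong head tail) (ℚ[x].≋-sym (ℚ[x].[]-⊗ (fromℤ (+ (ℚ.↧ₙ a ℕ.* d))) (a ∷ p)))
  where
  open ≡.≡-Reasoning
  open import Algebra.Properties.CommutativeSemigroup (CommutativeRing.*-commutativeSemigroup ℚ.+-*-commutativeRing) using (xy∙z≈xz∙y)
  head : fromℤ (ℚ.↥ a ℤ.* + d) ≡ fromℤ (+ (ℚ.↧ₙ a ℕ.* d)) ℚ.* a
  head = begin
    fromℤ (ℚ.↥ a ℤ.* + d)                      ≡⟨ fromℤ-* (ℚ.↥ a) (+ d) ⟩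
    fromℤ (ℚ.↥ a) ℚ.* fromℤ (+ d)              ≡⟨ ≡.cong (ℚ._* fromℤ (+ d)) (denominator*q≡numerator a) ⟨
    fromℤ (+ ℚ.↧ₙ a) ℚ.* a ℚ.* fromℤ (+ d)     ≡⟨ xy∙z≈xz∙y (fromℤ (+ ℚ.↧ₙ a)) a (fromℤ (+ d)) ⟩
    fromℤ (+ ℚ.↧ₙ a) ℚ.* fromℤ (+ d) ℚ.* a     ≡⟨ ≡.cong (ℚ._* a) (fromℤ-ℕ* (ℚ.↧ₙ a) d) ⟨
    fromℤ (+ (ℚ.↧ₙ a ℕ.* d)) ℚ.* a             ∎
  tail : toℚ[x] ((+ ℚ.↧ₙ a) ℤ[x].· P) ℚ[x].≋ fromℤ (+ (ℚ.↧ₙ a ℕ.* d)) ℚ[x].· p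
  tail = ℚ[x].≋-trans (ℤ→ℚ.map-· (+ ℚ.↧ₙ a) P) (ℚ[x].≋-trans
    (ℚ[x].·-cong {fromℤ (+ ℚ.↧ₙ a)} ≡.refl (ℚ[x].≋-trans P≋dp (ℚ[x].[]-⊗ (fromℤ (+ d)) p))) (ℚ[x].≋-trans
    (ℚ[x].≋-sym (ℚ[x].·-assoc (fromℤ (+ ℚ.↧ₙ a)) (fromℤ (+ d)) p))
    (ℚ[x].·-cong (≡.sym (fromℤ-ℕ* (ℚ.↧ₙ a) d)) (ℚ[x].≋-refl {p}))))

∣-clear-denominators : ∀ {p d P f} → 1 ≤ d → toℚ[x] P ℚ[x].≋ [ fromℤ (+ d) ] ℚ[x].⊗ p → p ℚ[x].∣ toℚ[x] f →
                       ∃ λ c → ∃ λ H → 1 ≤ c × H ℤ[x].⊗ P ℤ[x].≋ [ + c ] ℤ[x].⊗ f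
∣-clear-denominators {p} {d} {P} {f} d≥1 P≋dp (h , hp≋f) with clear-denominators h
... | dh , H , dh≥1 , H≋dh·h = dh ℕ.* d , H , ℕ.*-mono-≤ {1} {dh} {1} {d} dh≥1 d≥1 ,
  ℤ→ℚ.map-injective fromℤ-injective (begin
    toℚ[x] (H ℤ[x].⊗ P)                     ≈⟨ ℤ→ℚ.map-⊗ H P ⟩
    toℚ[x] H ⊗ toℚ[x] P                     ≈⟨ ⊗-cong H≋dh·h P≋dp ⟩
    ([ dh′ ] ⊗ h) ⊗ ([ d′ ] ⊗ p)             ≈⟨ solve 4 (λ a h b p → (a :* h) :* (b :* p) := (a :* b) :* (h :* p))
                                                       ≋-refl [ dh′ ] h [ d′ ] p ⟩
    ([ dh′ ] ⊗ [ d′ ]) ⊗ (h ⊗ p)             ≈⟨ ⊗-cong ([ℕ*] dh d) (≋-sym hp≋f) ⟨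
    [ fromℤ (+ (dh ℕ.* d)) ] ⊗ toℚ[x] f     ≈⟨ ℤ→ℚ.map-⊗ [ + (dh ℕ.* d) ] f ⟨
    toℚ[x] ([ + (dh ℕ.* d) ] ℤ[x].⊗ f)       ∎)
  where
  open ℚ[x]
  open Solver
  open SetoidReasoning ≋-setoid
  dh′ d′ : ℚ
  dh′ = fromℤ (+ dh)
  d′ = fromℤ (+ d)

coprime-clear-denominators :
  ∀ {p d P g} → 1 ≤ d → toℚ[x] P ℚ[x].≋ [ fromℤ (+ d) ] ℚ[x].⊗ p → ℚ[x].Coprime p (toℚ[x] g) →
  ∃ λ c → ∃ λ A → ∃ λ B → 1 ≤ c × A ℤ[x].⊗ P ℤ[x].⊕ B ℤ[x].⊗ g ℤ[x].≋ [ + c ]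
coprime-clear-denominators {p} {d} {P} {g} d≥1 P≋dp (U , V , Up+Vg≋1)
  with clear-denominators U | clear-denominators V
... | dU , U′ , dU≥1 , U′≋dU·U | dV , V′ , dV≥1 , V′≋dV·V =
  dU ℕ.* dV ℕ.* d , A , B , ℕ.*-mono-≤ {1} {dU ℕ.* dV} {1} {d} (ℕ.*-mono-≤ {1} {dU} {1} {dV} dU≥1 dV≥1) d≥1 ,
  ℤ→ℚ.map-injective fromℤ-injective (begin
    toℚ[x] (A ℤ[x].⊗ P ℤ[x].⊕ B ℤ[x].⊗ g)
      ≈⟨ ≋-trans (ℤ→ℚ.map-⊕ (A ℤ[x].⊗ P) (B ℤ[x].⊗ g)) (⊕-cong (ℤ→ℚ.map-⊗ A P) (ℤ→ℚ.map-⊗ B g)) ⟩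
    toℚ[x] A ⊗ toℚ[x] P ⊕ toℚ[x] B ⊗ g̃
      ≈⟨ ⊕-cong (⊗-cong (≋-trans (ℤ→ℚ.map-⊗ [ + dV ] U′) (⊗-congʳ [ dV′ ] U′≋dU·U)) P≋dp)
                (⊗-congˡ g̃ (≋-trans (ℤ→ℚ.map-⊗ [ + (dU ℕ.* d) ] V′) (⊗-cong ([ℕ*] dU d) V′≋dV·V))) ⟩
    ([ dV′ ] ⊗ ([ dU′ ] ⊗ U)) ⊗ ([ d′ ] ⊗ p) ⊕ (([ dU′ ] ⊗ [ d′ ]) ⊗ ([ dV′ ] ⊗ V)) ⊗ g̃
      ≈⟨ solve 7 (λ a b c U V p g → (b :* (a :* U)) :* (c :* p) :+ ((a :* c) :* (b :* V)) :* g
                                      := ((a :* b) :* c) :* (U :* p :+ V :* g))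
               ≋-refl [ dU′ ] [ dV′ ] [ d′ ] U V p g̃ ⟩
    (([ dU′ ] ⊗ [ dV′ ]) ⊗ [ d′ ]) ⊗ (U ⊗ p ⊕ V ⊗ g̃)
      ≈⟨ ≋-trans (⊗-congʳ k Up+Vg≋1) (⊗-identityʳ k) ⟩
    ([ dU′ ] ⊗ [ dV′ ]) ⊗ [ d′ ]
      ≈⟨ ≋-trans ([ℕ*] (dU ℕ.* dV) d) (⊗-congˡ [ d′ ] ([ℕ*] dU dV)) ⟨
    [ fromℤ (+ (dU ℕ.* dV ℕ.* d)) ]
      ∎)
  where
  open ℚ[x]
  open Solver
  open SetoidReasoning ≋-setoid
  A B : Polyℤ
  A = [ + dV ] ℤ[x].⊗ U′
  B = [ + (dU ℕ.* d) ] ℤ[x].⊗ V′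
  dU′ dV′ d′ : ℚ
  dU′ = fromℤ (+ dU)
  dV′ = fromℤ (+ dV)
  d′ = fromℤ (+ d)
  g̃ k : Polyℚ
  g̃ = toℚ[x] g
  k = ([ dU′ ] ⊗ [ dV′ ]) ⊗ [ d′ ]

RootsIncludedForLargePrimes : Polyℤ → Polyℤ → Set₁
RootsIncludedForLargePrimes f g = ∀ N → Σ ℕ λ ℓ → N < ℓ × Prime ℓ × RootsIncludedInChar ℓ f g

integral-identities-impossible :
  ∀ {f g P H A B c₁ c₂ d dp} → RootsIncludedForLargePrimes f g →
  H ℤ[x].⊗ P ℤ[x].≋ [ + c₁ ] ℤ[x].⊗ f → A ℤ[x].⊗ P ℤ[x].⊕ B ℤ[x].⊗ g ℤ[x].≋ [ + c₂ ] →
  1 ≤ c₁ → 1 ≤ c₂ → 1 ≤ d → 1 ≤ dp → ℤ[x].coef P dp ≡ + d → ⊥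
integral-identities-impossible {f} {g} {P} {H} {A} {B} {c₁} {c₂} {d} {dp}
  roots HP≋c₁f AP+Bg≋c₂ c₁≥1 c₂≥1 d≥1 dp≥1 coef-P≡d =
  let (ℓ , N<ℓ , ℓ-prime , rootsℓ) = roots (d ℕ.+ c₁ ℕ.+ c₂)
      open IntegersModPrime ℓ ℓ-prime
      open Reduction commutativeRing isField _≡ₘ0?
      open CommutativeRing commutativeRing using () renaming (trans to ≈-trans; sym to ≈-sym)
      +m≢ₘ0 : ∀ {m} → 1 ≤ m → m ℕ.≤ d ℕ.+ c₁ ℕ.+ c₂ → ¬ intK commutativeRing (+ m) ≡ₘ 0ℤ
      +m≢ₘ0 {m} 1≤m m≤N = ≡.subst (λ k → ¬ k ≡ₘ 0ℤ) (≡.sym (natK≡id m)) (0<m<ℓ⇒≢ₘ0 1≤m (ℕ.≤-<-trans m≤N N<ℓ))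
      P̄-constant : Polynomial.IsConstant commutativeRing (reduce P)
      P̄-constant = divisor-coprime-to-g-reduces-to-constant {ℓ} {f} {g} hasChar rootsℓ
        {P} {H} {A} {B} {+ c₁} {+ c₂} HP≋c₁f AP+Bg≋c₂
        (+m≢ₘ0 c₁≥1 (ℕ.≤-trans (ℕ.m≤n+m c₁ d) (ℕ.m≤m+n (d ℕ.+ c₁) c₂)))
        (+m≢ₘ0 c₂≥1 (ℕ.m≤n+m c₂ (d ℕ.+ c₁)))
  in +m≢ₘ0 d≥1 (ℕ.≤-trans (ℕ.m≤m+n d c₁) (ℕ.m≤m+n (d ℕ.+ c₁) c₂))
       (≡.subst (λ k → intK commutativeRing k ≡ₘ 0ℤ) coef-P≡d
         (≈-trans (≈-sym (coef-reduce P dp)) (P̄-constant dp dp≥1)))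

cleared-leading-coefficient : ∀ {p d P n} → toℚ[x] P ℚ[x].≋ [ fromℤ (+ d) ] ℚ[x].⊗ p →
                              ℚ[x].coef p n ≡ 1ℚ → ℤ[x].coef P n ≡ + d
cleared-leading-coefficient {p} {d} {P} {n} P≋dp coef-p≡1 = fromℤ-injective (begin
  fromℤ (ℤ[x].coef P n)                     ≡⟨ ℤ→ℚ.coef-map P n ⟨
  ℚ[x].coef (toℚ[x] P) n                    ≡⟨ ℚ[x].at P≋dp n ⟩
  ℚ[x].coef ([ fromℤ (+ d) ] ℚ[x].⊗ p) n    ≡⟨ ℚ[x].coef-[]⊗ (fromℤ (+ d)) p n ⟩
  fromℤ (+ d) ℚ.* ℚ[x].coef p n             ≡⟨ ≡.cong (fromℤ (+ d) ℚ.*_) coef-p≡1 ⟩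
  fromℤ (+ d) ℚ.* 1ℚ                        ≡⟨ ℚ.*-identityʳ (fromℤ (+ d)) ⟩
  fromℤ (+ d)                               ∎)
  where open ≡.≡-Reasoning

monic-factor-not-coprime : ∀ {f g} → RootsIncludedForLargePrimes f g →
  ∀ {p} → ℚ[x].IsMonic p → ¬ ℚ[x].IsConstant p → p ℚ[x].∣ toℚ[x] f → ¬ ℚ[x].Coprime p (toℚ[x] g)
monic-factor-not-coprime {f} {g} roots {p} (dp , lp≡1 , degP) p-nonconst p∣f p⊥g =
  let (d , P , d≥1 , P≋dp)          = clear-denominators p
      (c₁ , H , c₁≥1 , HP≋c₁f)      = ∣-clear-denominators {p} {d} {P} {f} d≥1 P≋dp p∣f
      (c₂ , A , B , c₂≥1 , AP+Bg≋c₂) = coprime-clear-denominators {p} {d} {P} {g} d≥1 P≋dp p⊥g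
  in integral-identities-impossible {f} {g} {P} {H} {A} {B} {c₁} {c₂} {d} {dp}
       roots HP≋c₁f AP+Bg≋c₂ c₁≥1 c₂≥1 d≥1
       (ℚ[x].nonconstant⇒degree≥1 {p} p-nonconst degP) (cleared-leading-coefficient {p} {d} {P} P≋dp lp≡1)

monic-irreducible-factor-divides : ∀ {f g} → RootsIncludedForLargePrimes f g →
  ∀ {p} → ℚ[x].IsMonic p → ¬ ℚ[x].IsConstant p → ℚ[x].IsIrreducible p → p ℚ[x].∣ toℚ[x] f → p ℚ[x].∣ toℚ[x] g
monic-irreducible-factor-divides {g = g} roots p-monic p-nonconst p-irreducible p∣f =
  [ id , (λ p⊥g → ⊥-elim (monic-factor-not-coprime roots p-monic p-nonconst p∣f p⊥g)) ]′
    (ℚ[x].irreducible⇒∣⊎coprime p-nonconst p-irreducible (toℚ[x] g))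

private
  +ₚ≡⊕ : ∀ p q → p +ₚ q ≡ p ℚ[x].⊕ q
  +ₚ≡⊕ []      q       = ≡.refl
  +ₚ≡⊕ (a ∷ p) []      = ≡.refl
  +ₚ≡⊕ (a ∷ p) (b ∷ q) = ≡.cong (a ℚ.+ b ∷_) (+ₚ≡⊕ p q)

  *ₚ≡⊗ : ∀ p q → p *ₚ q ≡ p ℚ[x].⊗ q
  *ₚ≡⊗ []      q = ≡.refl
  *ₚ≡⊗ (a ∷ p) q rewrite *ₚ≡⊗ p q = +ₚ≡⊕ (map (a ℚ.*_) q) (0ℚ ∷ p ℚ[x].⊗ q)

  prodₚ≡∏ : ∀ ps → prodₚ ps ≡ ℚ[x].∏ ps
  prodₚ≡∏ []       = ≡.refl
  prodₚ≡∏ (p ∷ ps) rewrite prodₚ≡∏ ps = *ₚ≡⊗ p (ℚ[x].∏ ps)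

  ^ₚ≡^ : ∀ p n → p ^ₚ n ≡ p ℚ[x].^ n
  ^ₚ≡^ p zero    = ≡.refl
  ^ₚ≡^ p (suc n) rewrite ^ₚ≡^ p n = *ₚ≡⊗ p (p ℚ[x].^ n)

  ∣⇒∣ₚ : ∀ {p q} → p ℚ[x].∣ q → p ∣ₚ q
  ∣⇒∣ₚ {p} (r , rp≋q) = r , λ n → ≡.trans (≡.cong (λ s → coeff 0ℚ s n) (*ₚ≡⊗ r p)) (ℚ[x].at rp≋q n)

  Irreducible⇒IsIrreducible : ∀ {p} → Irreducible p → ℚ[x].IsIrreducible p
  Irreducible⇒IsIrreducible (_ , split) a b p≋ab =
    split a b λ n → ≡.trans (ℚ[x].at p≋ab n) (≡.cong (λ s → coeff 0ℚ s n) (≡.sym (*ₚ≡⊗ a b)))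

powers : List (Polyℚ × ℕ) → List Polyℚ
powers = map (λ (p , e) → p ℚ[x].^ e)

IsFactorization⇒≋ : ∀ {F c fs} → IsFactorization F c fs → F ℚ[x].≋ [ c ] ℚ[x].⊗ ℚ[x].∏ (powers fs)
IsFactorization⇒≋ {F} {c} {fs} (_ , _ , _ , F≈) = ℚ[x].mk≋ λ n → ≡.trans (F≈ n) (≡.cong (λ s → coeff 0ℚ s n) (begin
  constₚ c *ₚ prodₚ (map (λ (p , e) → p ^ₚ e) fs)
    ≡⟨ ≡.cong (λ ps → constₚ c *ₚ prodₚ ps) (List.map-cong (λ (p , e) → ^ₚ≡^ p e) fs) ⟩
  constₚ c *ₚ prodₚ (powers fs)                  ≡⟨ ≡.cong (constₚ c *ₚ_) (prodₚ≡∏ (powers fs)) ⟩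
  constₚ c *ₚ ℚ[x].∏ (powers fs)                 ≡⟨ *ₚ≡⊗ (constₚ c) (ℚ[x].∏ (powers fs)) ⟩
  [ c ] ℚ[x].⊗ ℚ[x].∏ (powers fs)                ∎))
  where open ≡.≡-Reasoning

factor∣ : ∀ {F c fs p e} → IsFactorization F c fs → (p , e) ∈ fs → p ℚ[x].∣ F
factor∣ {F} {c} {fs} {p} {suc e} F-fact pe∈fs =
  ℚ[x].∣-respʳ (ℚ[x].≋-sym (IsFactorization⇒≋ F-fact))
    (ℚ[x].∣n⇒∣m⊗n [ c ] (ℚ[x].∣-trans (ℚ[x].∣m⇒∣m⊗n (p ℚ[x].^ e) (ℚ[x].∣-refl p))
                                       (ℚ[x].∈⇒∣∏ (∈-map⁺ (λ (p , e) → p ℚ[x].^ e) pe∈fs))))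
factor∣ {e = zero} (_ , fs-props , _) pe∈fs with All.lookup fs-props pe∈fs
... | _ , _ , ()

monic-irreducible∣factorization⇒associate :
  ∀ {G c gs p} → IsFactorization G c gs → ℚ[x].IsMonic p → ¬ ℚ[x].IsConstant p → ℚ[x].IsIrreducible p →
  p ℚ[x].∣ G → ℚ[x].AssociateIn (map proj₁ gs) p
monic-irreducible∣factorization⇒associate {G} {c} {gs} {p} G-fact@(c≢0 , gs-props , _) p-monic p-nonconst p-irreducible p∣G
  with ℚ[x].irreducible⇒prime p-nonconst p-irreducible [ c ] (ℚ[x].∏ (powers gs))
         (ℚ[x].∣-respʳ (IsFactorization⇒≋ G-fact) p∣G)
... | inj₁ p∣c = ⊥-elim (p-nonconst (ℚ[x].∣nonzero-constant⇒IsConstant c≢0 p∣c))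
... | inj₂ p∣∏ with ℚ[x].irreducible∣∏ p-nonconst p-irreducible (powers gs) p∣∏
...   | x , x∈powers , p∣x with ∈-map⁻ (λ (q , e) → q ℚ[x].^ e) x∈powers
...     | (q , e) , qe∈gs , ≡.refl = q , ∈-map⁺ proj₁ qe∈gs ,
  ℚ[x].monic∣monic-irreducible⇒≋ p-monic p-nonconst q-monic (Irreducible⇒IsIrreducible q-irreducible)
    (ℚ[x].irreducible∣^ p-nonconst p-irreducible q e p∣x)
  where
  q-monic : ℚ[x].IsMonic q
  q-monic = proj₁ (All.lookup gs-props qe∈gs)
  q-irreducible : Irreducible q
  q-irreducible = proj₁ (proj₂ (All.lookup gs-props qe∈gs))

rad∣rad : ∀ {F G cf cg fs gs} →
  (∀ {p} → ℚ[x].IsMonic p → ¬ ℚ[x].IsConstant p → ℚ[x].IsIrreducible p → p ℚ[x].∣ F → p ℚ[x].∣ G) →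
  IsFactorization F cf fs → IsFactorization G cg gs → radOf fs ∣ₚ radOf gs
rad∣rad {fs = fs} {gs} factor-of-F-divides-G F-fact@(_ , fs-props , fs-distinct , _) G-fact =
  ∣⇒∣ₚ (≡.subst₂ ℚ[x]._∣_ (≡.sym (prodₚ≡∏ (map proj₁ fs))) (≡.sym (prodₚ≡∏ (map proj₁ gs)))
    (ℚ[x].distinct⇒∏∣∏ (map proj₁ fs) (map proj₁ gs)
      (AllPairs.map (λ p≉ₚq p≋q → p≉ₚq (ℚ[x].at p≋q)) fs-distinct)
      (All.map⁺ (All.tabulate associate))))
  where
  associate : ∀ {pe} → pe ∈ fs → ℚ[x].AssociateIn (map proj₁ gs) (proj₁ pe)
  associate pe∈fs with All.lookup fs-props pe∈fs
  ... | p-monic , p-irreducible@(p-nonconst , _) , _ =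
    monic-irreducible∣factorization⇒associate G-fact p-monic p-nonconst (Irreducible⇒IsIrreducible p-irreducible)
      (factor-of-F-divides-G p-monic p-nonconst (Irreducible⇒IsIrreducible p-irreducible) (factor∣ F-fact pe∈fs))

lemma3p8 : (f g : Polyℤ) → Monicℤ f → Monicℤ g →
    (∀ N → Σ ℕ λ ℓ → N < ℓ × Prime ℓ ×
      ((K : CommutativeRing 0ℓ 0ℓ) → IsField K → HasChar K ℓ →
        ∀ x → CommutativeRing._≈_ K (evalℤ K f x) (CommutativeRing.0# K) →
              CommutativeRing._≈_ K (evalℤ K g x) (CommutativeRing.0# K))) →
    (cf cg : ℚ) (fs gs : List (Polyℚ × ℕ)) →
    IsFactorization (toℚ[x] f) cf fs → IsFactorization (toℚ[x] g) cg gs →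
    radOf fs ∣ₚ radOf gs
lemma3p8 f g _ _ roots cf cg fs gs f-fact g-fact =
  rad∣rad {toℚ[x] f} {toℚ[x] g} (monic-irreducible-factor-divides roots) f-fact g-fact
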